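{- The map $\tilde\varrho\colon\mathsf{W}\mathsf{C}_n\to\operatorname{IIC}_n$ sending an $\tilde n$-web to its right sequence couple is well defined (takes values in $\operatorname{IIC}_n$) and is a bijection.
   Context: Let $\mathbb{S}^1$ be $[1,n+1]$ with $1$ and $n+1$ glued. $\tilde n$-diagrams are the diagrams on the cylinder $\mathbb{S}^1\times[0,1]$ (maps from $n$ copies of $[0,1]$, each strand projecting vertically bijectively onto $[0,1]$, endpoints at $(k,0),(l,1)$ with $k,l\in\{1,\dots,n\}$, injective except at finitely many interior transverse double points, up to isotopy) obtained as stacked products of the elementary diagrams $\tilde d_1,\dots,\tilde d_n$, where $\tilde d_i$ has all strands vertical except two strands from $(i,0)$ to $(i+1,1)$ and from $(i+1,0)$ to $(i,1)$ crossing once (position $n+1$ meaning $1$). A bigon/triangle (region bounded by arcs of two strands between two crossings / of three strands between their pairwise crossings) is contractible if it bounds a disk in the cylinder. An $\tilde n$-web is an $\tilde n$-diagram without contractible bigons or triangles; $\mathsf{W}\mathsf{C}_n$ is the set of $\tilde n$-webs up to isotopy. Let $p\colon\mathbb{R}\times[0,1]\to\mathbb{S}^1\times[0,1]$ be the universal covering identifying $(x,y)$ with $(x+n,y)$. For a strand starting at $(a,0)$, $a\in\{1,\dots,n\}$, let $b$ be the $x$-coordinate of the upper endpoint of its lift to $\mathbb{R}\times[0,1]$ starting at $(a,0)$; the strand is called right if $b>a$. The right sequence couple of an $\tilde n$-web $w$ is $((a_t),(b_t))$ where $(a_t)$ is the increasing list of the starting positions of the right strands and $b_t$ the corresponding lift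 endpoints. $\operatorname{IIC}_n$ is the set of couples of integer sequences $((a_1,\dots,a_k),(b_1,\dots,b_k))$, for any $0\le k<n$, with $1\le a_1<\dots<a_k\le n$, $b_1<b_2<\dots<b_k<b_1+n$, and $a_t<b_t$ for all $t$. -}

module Defs where

open import Data.Nat as ℕ using (ℕ; zero; suc; NonZero; _%_)
open import Data.Fin as Fin using (Fin; toℕ; _<_)
open import Data.Integer as ℤ using (ℤ; +_; _+_; _-_; 1ℤ; _<?_)
open import Data.Integer.DivMod using (_%ℕ_)
open import Data.List using (List; []; _∷_; _++_; length; take; lookup; foldl; filter; map; upTo)
open import Data.List.Relation.Unary.All using (All)
open import Data.List.Relation.Unary.Linked using (Linked)
open import Data.List.Relation.Binary.Pointwise using (Pointwise)
open import Data.Product using (Σ; ∃; _×_; _,_)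
open import Data.Sum using (_⊎_)
open import Data.Unit using (⊤)
open import Relation.Nullary using (¬_; yes; no)
open import Relation.Binary.PropositionalEquality using (_≡_; _≢_)
open import Relation.Binary.Construct.Closure.ReflexiveTransitive using (Star)

-- A word i₁ i₂ … iₘ (list head = bottom of the cylinder) encodes the stacked
-- product of elementary diagrams; the letter i : Fin n stands for d̃_{toℕ i + 1}.
Word : ℕ → Set
Word n = List (Fin n)

module _ (n : ℕ) .{{_ : NonZero n}} where

  -- residue class of a position of the universal cover ℝ×[0,1] → 𝕊¹×[0,1]:
  -- positions 1,…,n (mod n) ↦ 0,…,n-1
  residue : ℤ → ℕ
  residue p = (p - 1ℤ) %ℕ n

  -- effect of d̃_{toℕ i + 1} on an integer position of the cover: positions
  -- ≡ i+1 and ≡ i+2 (mod n) in the same period are swapped.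
  stepPos : Fin n → ℤ → ℤ
  stepPos i p with residue p ℕ.≟ toℕ i | residue p ℕ.≟ (suc (toℕ i) % n)
  ... | yes _ | _     = p + 1ℤ
  ... | no _  | yes _ = p - 1ℤ
  ... | no _  | no _  = p

  -- upper x-coordinate of the lifted strand starting at (x,0) in the cover
  pos : Word n → ℤ → ℤ
  pos w x = foldl (λ p i → stepPos i p) x w

  Swaps : Fin n → ℤ → ℤ → Set
  Swaps i p q = residue p ≡ toℕ i × q ≡ p + 1ℤ

  CrossAt : (w : Word n) → Fin (length w) → ℤ → ℤ → Set
  CrossAt w t x y =
    Swaps (lookup w t) (pos (take (toℕ t) w) x) (pos (take (toℕ t) w) y)
    ⊎ Swaps (lookup w t) (pos (take (toℕ t) w) y) (pos (take (toℕ t) w) x)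

  -- contractible bigon: two lifts crossing at two different crossings
  HasContractibleBigon : Word n → Set
  HasContractibleBigon w =
    Σ ℤ λ x → Σ ℤ λ y → Σ (Fin (length w)) λ s → Σ (Fin (length w)) λ t →
      s < t × CrossAt w s x y × CrossAt w t x y

  -- contractible triangle: three lifts crossing pairwise
  HasContractibleTriangle : Word n → Set
  HasContractibleTriangle w =
    Σ ℤ λ x → Σ ℤ λ y → Σ ℤ λ z →
    Σ (Fin (length w)) λ s → Σ (Fin (length w)) λ t → Σ (Fin (length w)) λ u →
      CrossAt w s x y × CrossAt w t y z × CrossAt w u x z

  IsWeb : Word n → Set
  IsWeb w = ¬ HasContractibleBigon w × ¬ HasContractibleTriangle w

  FarApart : Fin n → Fin n → Set
  FarApart i j = toℕ i ≢ toℕ j × suc (toℕ i) % n ≢ toℕ j × suc (toℕ j) % n ≢ toℕ i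

  -- elementary isotopy: sliding two far-apart crossings past each other
  data Commute : Word n → Word n → Set where
    swap : ∀ (u v : Word n) (i j : Fin n) → FarApart i j →
           Commute (u ++ i ∷ j ∷ v) (u ++ j ∷ i ∷ v)

  Isotopic : Word n → Word n → Set
  Isotopic = Star Commute

  startPositions : List ℤ
  startPositions = map (λ k → + suc k) (upTo n)

  rightStarts : Word n → List ℤ
  rightStarts w = filter (λ a → a <? pos w a) startPositions

  rsc : Word n → List ℤ × List ℤ
  rsc w = rightStarts w , map (pos w) (rightStarts w)

  lastOf : ℤ → List ℤ → ℤ
  lastOf b []       = b
  lastOf _ (c ∷ cs) = lastOf c cs

  WrapBound : List ℤ → Set
  WrapBound []       = ⊤
  WrapBound (b ∷ bs) = lastOf b bs ℤ.< b + + n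

  record IIC (c : List ℤ × List ℤ) : Set where
    constructor mkIIC
    field
      lenLt     : length (Data.Product.proj₁ c) ℕ.< n
      aRange    : All (λ a → + 1 ℤ.≤ a × a ℤ.≤ + n) (Data.Product.proj₁ c)
      aIncr     : Linked ℤ._<_ (Data.Product.proj₁ c)
      bIncr     : Linked ℤ._<_ (Data.Product.proj₂ c)
      bWrap     : WrapBound (Data.Product.proj₂ c)
      aLtb      : Pointwise ℤ._<_ (Data.Product.proj₁ c) (Data.Product.proj₂ c)

-- Everything is lifted to the universal cover, where a word w acts on ℤ by the
-- permutation ⟦ w ⟧ sending the start of a strand to its end; ⟦ w ⟧ commutes with
-- translation by n.  Strands ending in the opposite order must cross, and in a
-- web (no bigon, no triangle) every crossing pair ends inverted and no three
-- strands are pairwise inverted.  Hence the strands moving right keep their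
-- order, and so do the others, which gives the IIC conditions; commuting
-- far-apart letters does not change ⟦ w ⟧.  Injectivity: the first letter s of
-- a web swaps a right strand with a non-right one, so in any web with the same
-- right strands that pair ends inverted, and every letter before it either is
-- s or commutes with s (otherwise three strands would be pairwise inverted);
-- move s to the front and induct.  Surjectivity: build the web letter by
-- letter.  Where a moving residue r is followed by a resting one, put the
-- letter r first and let the strand at r + 1 take over the displacement of the
-- strand at r minus one; the total displacement drops by one.

module Submission where

open import Data.Empty using (⊥; ⊥-elim)
open import Data.Fin as Fin using (Fin; toℕ; fromℕ<)
import Data.Fin.Properties as Finₚ
open import Data.Integer as ℤ using (ℤ; +_; -[1+_]; _+_; _-_; _*_; -_; 0ℤ; 1ℤ)
import Data.Integer.Properties as ℤₚ
open import Data.Integer.DivMod using (_/ℕ_; a≡a%ℕn+[a/ℕn]*n; n%ℕd<d)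
open import Data.Integer.Tactic.RingSolver using (solve-∀)
open import Data.List using (List; []; _∷_; _++_; length; map; upTo)
import Data.List.Properties as Listₚ
open import Data.List.Membership.DecPropositional ℤ._≟_ using (_∈?_)
open import Data.List.Membership.Propositional using (_∈_)
import Data.List.Membership.Propositional.Properties as ∈ₚ
open import Data.List.Relation.Binary.Pointwise using (Pointwise; []; _∷_)
open import Data.List.Relation.Binary.Subset.Propositional using (_⊆_)
open import Data.List.Relation.Unary.All as All using (All; []; _∷_)
open import Data.List.Relation.Unary.AllPairs using (_∷_)
open import Data.List.Relation.Unary.Any as Any using (here; there)
open import Data.List.Relation.Unary.Linked as Linked using (Linked; []; [-]; _∷_)
import Data.List.Relation.Unary.Linked.Properties as Linkedₚ
open import Data.Nat as ℕ using (ℕ; zero; suc; NonZero; _%_)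
import Data.Nat.DivMod as ℕD
import Data.Nat.Properties as ℕₚ
open import Algebra.Properties.CommutativeSemigroup ℕₚ.+-commutativeSemigroup using () renaming (xy∙z≈xz∙y to +-right-comm)
open import Data.Product using (Σ; ∃-syntax; _×_; _,_; proj₁; proj₂)
open import Data.Sum as Sum using (_⊎_; inj₁; inj₂)
open import Data.Unit using (tt)
open import Function using (id; _∘_; _∘′_)
open import Relation.Binary.Construct.Closure.ReflexiveTransitive as Star using (ε; _◅_; _◅◅_)
open import Relation.Binary.Core using (Rel; REL)
open import Relation.Binary.Definitions using (Transitive; Asymmetric; Tri; tri<; tri≈; tri>)
open import Relation.Binary.PropositionalEquality
open import Relation.Nullary using (¬_; yes; no; Dec)
open import Relation.Nullary.Decidable using (_×-dec_)
open import Relation.Unary using (Decidable)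

open import Defs

module _ {a ℓ} {A : Set a} {_≺_ : Rel A ℓ} (≺-trans : Transitive _≺_) (≺-asym : Asymmetric _≺_) where

  head≺tail : ∀ {x xs} → Linked _≺_ (x ∷ xs) → All (x ≺_) xs
  head≺tail sorted with x≺xs ∷ _ ← Linkedₚ.Linked⇒AllPairs ≺-trans sorted = x≺xs

  private
    heads-≡ : ∀ {x xs y ys} → Linked _≺_ (x ∷ xs) → Linked _≺_ (y ∷ ys) →
              x ∈ y ∷ ys → y ∈ x ∷ xs → x ≡ y
    heads-≡ _ _ (here x≡y) _ = x≡y
    heads-≡ _ _ (there _) (here y≡x) = sym y≡x
    heads-≡ sx sy (there x∈ys) (there y∈xs) =
      ⊥-elim (≺-asym (All.lookup (head≺tail sy) x∈ys) (All.lookup (head≺tail sx) y∈xs))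

    tails-⊆ : ∀ {x xs ys} → Linked _≺_ (x ∷ xs) → x ∷ xs ⊆ x ∷ ys → xs ⊆ ys
    tails-⊆ sx ⊆ z∈xs with ⊆ (there z∈xs)
    ... | here refl = ⊥-elim (≺-asym x≺x x≺x) where x≺x = All.lookup (head≺tail sx) z∈xs
    ... | there z∈ys = z∈ys

  sorted-extensional : ∀ {xs ys} → Linked _≺_ xs → Linked _≺_ ys → xs ⊆ ys → ys ⊆ xs → xs ≡ ys
  sorted-extensional {[]} {[]} _ _ _ _ = refl
  sorted-extensional {[]} {_ ∷ _} _ _ _ ys⊆xs with () ← ys⊆xs (here refl)
  sorted-extensional {_ ∷ _} {[]} _ _ xs⊆ys _ with () ← xs⊆ys (here refl)
  sorted-extensional {x ∷ xs} {y ∷ ys} sx sy xs⊆ys ys⊆xs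
    with refl ← heads-≡ sx sy (xs⊆ys (here refl)) (ys⊆xs (here refl)) =
    cong (x ∷_) (sorted-extensional (Linked.tail sx) (Linked.tail sy) (tails-⊆ sx xs⊆ys) (tails-⊆ sy ys⊆xs))

module _ where
  open import Data.Nat using (_<_)

  sumTo : (ℕ → ℕ) → ℕ → ℕ
  sumTo f zero    = 0
  sumTo f (suc k) = sumTo f k ℕ.+ f k

  _[_]≔_ : (ℕ → ℕ) → ℕ → ℕ → ℕ → ℕ
  (f [ a ]≔ v) r with r ℕ.≟ a
  ... | yes _ = v
  ... | no _  = f r

  update-same : ∀ f a v → (f [ a ]≔ v) a ≡ v
  update-same f a v with a ℕ.≟ a
  ... | yes _  = refl
  ... | no a≢a = ⊥-elim (a≢a refl)

  update-other : ∀ f {a r} v → r ≢ a → (f [ a ]≔ v) r ≡ f r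
  update-other f {a} {r} v r≢a with r ℕ.≟ a
  ... | yes r≡a = ⊥-elim (r≢a r≡a)
  ... | no _    = refl

  sumTo-cong : ∀ {f g} k → (∀ {r} → r < k → f r ≡ g r) → sumTo f k ≡ sumTo g k
  sumTo-cong zero    f≗g = refl
  sumTo-cong (suc k) f≗g = cong₂ ℕ._+_ (sumTo-cong k (f≗g ∘′ ℕₚ.m<n⇒m<1+n)) (f≗g (ℕₚ.n<1+n k))

  sumTo-update : ∀ f {a} v k → a < k → sumTo (f [ a ]≔ v) k ℕ.+ f a ≡ sumTo f k ℕ.+ v
  sumTo-update f {a} v (suc k) a<1+k with ℕₚ.m≤n⇒m<n∨m≡n (ℕₚ.≤-pred a<1+k)
  ... | inj₂ refl = begin
    sumTo (f [ a ]≔ v) a ℕ.+ (f [ a ]≔ v) a ℕ.+ f a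
      ≡⟨ cong₂ (λ s x → s ℕ.+ x ℕ.+ f a) (sumTo-cong a (λ r<a → update-other f v (ℕₚ.<⇒≢ r<a))) (update-same f a v) ⟩
    sumTo f a ℕ.+ v ℕ.+ f a
      ≡⟨ +-right-comm (sumTo f a) v (f a) ⟩
    sumTo f a ℕ.+ f a ℕ.+ v ∎
    where open ≡-Reasoning
  ... | inj₁ a<k = begin
    sumTo (f [ a ]≔ v) k ℕ.+ (f [ a ]≔ v) k ℕ.+ f a
      ≡⟨ cong (λ x → sumTo (f [ a ]≔ v) k ℕ.+ x ℕ.+ f a) (update-other f v (ℕₚ.<⇒≢ a<k ∘ sym)) ⟩
    sumTo (f [ a ]≔ v) k ℕ.+ f k ℕ.+ f a
      ≡⟨ +-right-comm (sumTo (f [ a ]≔ v) k) (f k) (f a) ⟩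
    sumTo (f [ a ]≔ v) k ℕ.+ f a ℕ.+ f k
      ≡⟨ cong (ℕ._+ f k) (sumTo-update f v k a<k) ⟩
    sumTo f k ℕ.+ v ℕ.+ f k
      ≡⟨ +-right-comm (sumTo f k) v (f k) ⟩
    sumTo f k ℕ.+ f k ℕ.+ v ∎
    where open ≡-Reasoning

transition : ∀ {p} {P : ℕ → Set p} → Decidable P → P 0 → ∀ k → ¬ P k → ∃[ j ] P j × ¬ P (suc j)
transition P? P0 zero    ¬Pk = ⊥-elim (¬Pk P0)
transition P? P0 (suc k) ¬P1+k with P? k
... | yes Pk = k , Pk , ¬P1+k
... | no ¬Pk = transition P? P0 k ¬Pk

map-≡⇒≡ : ∀ {a b} {A : Set a} {B : Set b} {f g : A → B} {xs x} → map f xs ≡ map g xs → x ∈ xs → f x ≡ g x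
map-≡⇒≡ {xs = _ ∷ _} eq (here refl) = proj₁ (Listₚ.∷-injective eq)
map-≡⇒≡ {xs = _ ∷ _} eq (there x∈xs) = map-≡⇒≡ (proj₂ (Listₚ.∷-injective eq)) x∈xs

module _ {a p r s} {A : Set a} {P : A → Set p} {R : Rel A r} {S : Rel A s} where

  linked-map-All : (∀ {x y} → P x → P y → R x y → S x y) → ∀ {xs} → All P xs → Linked R xs → Linked S xs
  linked-map-All f _                []           = []
  linked-map-All f _                [-]          = [-]
  linked-map-All f (px ∷ py ∷ pxs) (rxy ∷ rxs)  = f px py rxy ∷ linked-map-All f (py ∷ pxs) rxs

All⇒Pointwise-map : ∀ {a b r} {A : Set a} {B : Set b} {R : REL A B r} {f : A → B} {xs} →
                    All (λ x → R x (f x)) xs → Pointwise R xs (map f xs)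
All⇒Pointwise-map []         = []
All⇒Pointwise-map (rx ∷ rxs) = rx ∷ All⇒Pointwise-map rxs

module _ where
  open import Data.Integer using (_<_; _≤_)

  i-1+1≡i : ∀ i → i - 1ℤ + 1ℤ ≡ i
  i-1+1≡i = solve-∀

  i+1-1≡i : ∀ i → i + 1ℤ - 1ℤ ≡ i
  i+1-1≡i = solve-∀

  i+j-j≡i : ∀ i j → i + j - j ≡ i
  i+j-j≡i = solve-∀

  +-cancelʳ-≡ : ∀ {i j} k → i + k ≡ j + k → i ≡ j
  +-cancelʳ-≡ {i} {j} k eq = trans (sym (i+j-j≡i i k)) (trans (cong (_- k) eq) (i+j-j≡i j k))

  +-cancelʳ-< : ∀ {i j} k → i + k < j + k → i < j
  +-cancelʳ-< k i+k<j+k = subst₂ _<_ (i+j-j≡i _ k) (i+j-j≡i _ k) (ℤₚ.+-monoˡ-< (- k) i+k<j+k)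

  i<i+1 : ∀ i → i < i + 1ℤ
  i<i+1 i = ℤₚ.suc[i]≤j⇒i<j (ℤₚ.≤-reflexive (ℤₚ.+-comm 1ℤ i))

  i-1<i : ∀ i → i - 1ℤ < i
  i-1<i i = subst (i - 1ℤ <_) (i-1+1≡i i) (i<i+1 (i - 1ℤ))

  i≤i+1 : ∀ i → i ≤ i + 1ℤ
  i≤i+1 = ℤₚ.<⇒≤ ∘ i<i+1

  i-1≤i : ∀ i → i - 1ℤ ≤ i
  i-1≤i = ℤₚ.<⇒≤ ∘ i-1<i

  i<j⇒i+1≤j : ∀ {i j} → i < j → i + 1ℤ ≤ j
  i<j⇒i+1≤j {i} i<j = subst (_≤ _) (ℤₚ.+-comm 1ℤ i) (ℤₚ.i<j⇒suc[i]≤j i<j)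

  i+1≤j⇒i<j : ∀ {i j} → i + 1ℤ ≤ j → i < j
  i+1≤j⇒i<j {i} i+1≤j = ℤₚ.suc[i]≤j⇒i<j (subst (_≤ _) (ℤₚ.+-comm i 1ℤ) i+1≤j)

  i<j⇒i≤j-1 : ∀ {i j} → i < j → i ≤ j - 1ℤ
  i<j⇒i≤j-1 {i} {j} i<j = subst (_≤ j - 1ℤ) (i+1-1≡i i) (ℤₚ.+-monoˡ-≤ (- 1ℤ) (i<j⇒i+1≤j i<j))

  i<j+1⇒i≤j : ∀ {i j} → i < j + 1ℤ → i ≤ j
  i<j+1⇒i≤j {i} {j} i<j+1 = subst (i ≤_) (i+1-1≡i j) (i<j⇒i≤j-1 i<j+1)

  i<i+pos : ∀ x {d} → 0 ℕ.< d → x < x + + d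
  i<i+pos x 0<d = subst (_< x + + _) (ℤₚ.+-identityʳ x) (ℤₚ.+-monoʳ-< x (ℤ.+<+ 0<d))

  0<j-i : ∀ {i j} → i < j → 0ℤ < j - i
  0<j-i {i} {j} i<j = subst (_< j - i) (ℤₚ.+-inverseʳ i) (ℤₚ.+-monoˡ-< (- i) i<j)

  i<j⇒j≡i+suc : ∀ {i j} → i < j → ∃[ m ] j ≡ i + + suc m
  i<j⇒j≡i+suc {i} {j} i<j with j - i in j-i≡
  ... | + zero   = ⊥-elim (ℤₚ.<-irrefl (sym (ℤₚ.i-j≡0⇒i≡j j i j-i≡)) i<j)
  ... | + suc m  = m , trans (j≡i+[j-i] i j) (cong (_+_ i) j-i≡)
    where
    j≡i+[j-i] : ∀ i j → j ≡ i + (j - i)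
    j≡i+[j-i] = solve-∀
  ... | -[1+ m ] with () ← subst (0ℤ ≤_) j-i≡ (ℤₚ.i≤j⇒0≤j-i (ℤₚ.<⇒≤ i<j))

  assoc : List ℤ → List ℤ → ℤ → ℤ
  assoc (a ∷ as) (b ∷ bs) x with x ℤ.≟ a
  ... | yes _ = b
  ... | no _  = assoc as bs x
  assoc _ _ x = x

  private
    ∈-tail : ∀ {x a : ℤ} {as} → x ∈ a ∷ as → x ≢ a → x ∈ as
    ∈-tail (here x≡a) x≢a = ⊥-elim (x≢a x≡a)
    ∈-tail (there x∈) _   = x∈

  assoc-moved⇒∈ : ∀ {as bs x} → assoc as bs x ≢ x → x ∈ as
  assoc-moved⇒∈ {[]}     {_}      moved = ⊥-elim (moved refl)
  assoc-moved⇒∈ {_ ∷ _}  {[]}     moved = ⊥-elim (moved refl)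
  assoc-moved⇒∈ {a ∷ as} {b ∷ bs} {x} moved with x ℤ.≟ a
  ... | yes x≡a = here x≡a
  ... | no _    = there (assoc-moved⇒∈ moved)

  module _ {ℓ} {R : ℤ → ℤ → Set ℓ} where

    assoc-related : ∀ {as bs x} → Pointwise R as bs → x ∈ as → R x (assoc as bs x)
    assoc-related {a ∷ as} {x = x} (r ∷ rs) x∈ with x ℤ.≟ a
    ... | yes refl = r
    ... | no x≢a   = assoc-related rs (∈-tail x∈ x≢a)

    assoc-∈ : ∀ {as bs x} → Pointwise R as bs → x ∈ as → assoc as bs x ∈ bs
    assoc-∈ {a ∷ as} {x = x} (r ∷ rs) x∈ with x ℤ.≟ a
    ... | yes _  = here refl
    ... | no x≢a = there (assoc-∈ rs (∈-tail x∈ x≢a))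

    map-assoc : ∀ {as bs} → Linked _<_ as → Pointwise R as bs → map (assoc as bs) as ≡ bs
    map-assoc []                 []       = refl
    map-assoc {a ∷ as} {b ∷ bs} sorted (_ ∷ rs) = cong₂ _∷_ head≡ (trans tail≡ (map-assoc (Linked.tail sorted) rs))
      where
      head≡ : assoc (a ∷ as) (b ∷ bs) a ≡ b
      head≡ with a ℤ.≟ a
      ... | yes _  = refl
      ... | no a≢a = ⊥-elim (a≢a refl)
      skip : ∀ {z} → a < z → assoc (a ∷ as) (b ∷ bs) z ≡ assoc as bs z
      skip {z} a<z with z ℤ.≟ a
      ... | yes z≡a = ⊥-elim (ℤₚ.<-irrefl (sym z≡a) a<z)
      ... | no _    = refl
      tail≡ : map (assoc (a ∷ as) (b ∷ bs)) as ≡ map (assoc as bs) as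
      tail≡ = Listₚ.map-cong-local (All.map skip (head≺tail ℤₚ.<-trans ℤₚ.<-asym sorted))

    assoc-mono : ∀ {as bs x y} → Linked _<_ as → Linked _<_ bs → Pointwise R as bs →
                 x ∈ as → y ∈ as → x < y → assoc as bs x < assoc as bs y
    assoc-mono {a ∷ as} {b ∷ bs} {x} {y} sa sb (_ ∷ rs) x∈ y∈ x<y with x ℤ.≟ a | y ℤ.≟ a
    ... | yes refl | yes refl = ⊥-elim (ℤₚ.<-irrefl refl x<y)
    ... | no x≢a   | yes refl = ⊥-elim (ℤₚ.<-asym x<y (All.lookup (head≺tail ℤₚ.<-trans ℤₚ.<-asym sa) (∈-tail x∈ x≢a)))
    ... | yes refl | no y≢a   = All.lookup (head≺tail ℤₚ.<-trans ℤₚ.<-asym sb) (assoc-∈ rs (∈-tail y∈ y≢a))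
    ... | no x≢a   | no y≢a   = assoc-mono (Linked.tail sa) (Linked.tail sb) rs (∈-tail x∈ x≢a) (∈-tail y∈ y≢a) x<y

  head≤ : ∀ {b bs v} → Linked _<_ (b ∷ bs) → v ∈ b ∷ bs → b ≤ v
  head≤ _      (here refl) = ℤₚ.≤-refl
  head≤ sorted (there v∈)  = ℤₚ.<⇒≤ (All.lookup (head≺tail ℤₚ.<-trans ℤₚ.<-asym sorted) v∈)

  missing-or-⊆ : ∀ (ys xs : List ℤ) → (∃[ z ] z ∈ xs × ¬ z ∈ ys) ⊎ xs ⊆ ys
  missing-or-⊆ ys []       = inj₂ λ ()
  missing-or-⊆ ys (x ∷ xs) with x ∈? ys | missing-or-⊆ ys xs
  ... | no x∉ys | _                     = inj₁ (x , here refl , x∉ys)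
  ... | yes _   | inj₁ (z , z∈xs , z∉ys) = inj₁ (z , there z∈xs , z∉ys)
  ... | yes x∈ys | inj₂ xs⊆ys           = inj₂ λ { (here refl) → x∈ys ; (there z∈xs) → xs⊆ys z∈xs }

-- Residues, letters and endpoints on the universal cover

module Cover (n : ℕ) .{{_ : NonZero n}} where
  open import Data.Integer using (_<_; _≤_)

  res : ℤ → ℕ
  res = residue n

  quot : ℤ → ℤ
  quot x = (x - 1ℤ) /ℕ n

  res<n : ∀ x → res x ℕ.< n
  res<n x = n%ℕd<d (x - 1ℤ) n

  private
    a+b+1≡1+a+b : ∀ a b → a + b + 1ℤ ≡ 1ℤ + a + b
    a+b+1≡1+a+b = solve-∀

    a+b+c≡a+c+b : ∀ a b c → a + b + c ≡ a + c + b
    a+b+c≡a+c+b = solve-∀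

  res-quot : ∀ x → x ≡ + suc (res x) + quot x * + n
  res-quot x = begin
    x                              ≡⟨ i-1+1≡i x ⟨
    x - 1ℤ + 1ℤ                    ≡⟨ cong (_+ 1ℤ) (a≡a%ℕn+[a/ℕn]*n (x - 1ℤ) n) ⟩
    + res x + quot x * + n + 1ℤ    ≡⟨ a+b+1≡1+a+b (+ res x) (quot x * + n) ⟩
    + suc (res x) + quot x * + n   ∎
    where open ≡-Reasoning

  private
    remainder-unique-< : ∀ {r r′ q q′} → r ℕ.< n → q < q′ → + suc r + q * + n ≢ + suc r′ + q′ * + n
    remainder-unique-< {r} {r′} {q} {q′} r<n q<q′ eq = ℕₚ.<⇒≱ r<n n≤r
      where
      m = proj₁ (i<j⇒j≡i+suc q<q′)
      q′≡ = proj₂ (i<j⇒j≡i+suc q<q′)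
      a≡a+b-b : ∀ a b → a ≡ a + b - b
      a≡a+b-b = solve-∀
      a+[q+s]N-qN≡a+sN : ∀ a q s N → a + (q + s) * N - q * N ≡ a + s * N
      a+[q+s]N-qN≡a+sN = solve-∀
      1+r≡ : + suc r ≡ + suc (r′ ℕ.+ suc m ℕ.* n)
      1+r≡ = begin
        + suc r                                   ≡⟨ a≡a+b-b (+ suc r) (q * + n) ⟩
        + suc r + q * + n - q * + n               ≡⟨ cong (_- q * + n) eq ⟩
        + suc r′ + q′ * + n - q * + n             ≡⟨ cong (λ v → + suc r′ + v * + n - q * + n) q′≡ ⟩
        + suc r′ + (q + + suc m) * + n - q * + n  ≡⟨ a+[q+s]N-qN≡a+sN (+ suc r′) q (+ suc m) (+ n) ⟩
        + suc r′ + + suc m * + n                  ≡⟨ cong (_+_ (+ suc r′)) (ℤₚ.pos-* (suc m) n) ⟨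
        + suc (r′ ℕ.+ suc m ℕ.* n)                ∎
        where open ≡-Reasoning
      n≤r : n ℕ.≤ r
      n≤r = begin
        n                      ≤⟨ ℕₚ.m≤m+n n (m ℕ.* n) ⟩
        suc m ℕ.* n            ≤⟨ ℕₚ.m≤n+m _ r′ ⟩
        r′ ℕ.+ suc m ℕ.* n     ≡⟨ ℕₚ.suc-injective (ℤₚ.+-injective 1+r≡) ⟨
        r                      ∎
        where open ℕₚ.≤-Reasoning

  remainder-unique : ∀ {r r′} q q′ → r ℕ.< n → r′ ℕ.< n → + suc r + q * + n ≡ + suc r′ + q′ * + n → r ≡ r′
  remainder-unique q q′ r<n r′<n eq with ℤₚ.<-cmp q q′
  ... | tri< q<q′ _ _ = ⊥-elim (remainder-unique-< r<n q<q′ eq)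
  ... | tri≈ _ refl _ = ℕₚ.suc-injective (ℤₚ.+-injective (+-cancelʳ-≡ (q * + n) eq))
  ... | tri> _ _ q′<q = ⊥-elim (remainder-unique-< r′<n q′<q (sym eq))

  res-+*n : ∀ r q → r ℕ.< n → res (+ suc r + q * + n) ≡ r
  res-+*n r q r<n = remainder-unique (quot x) q (res<n x) r<n (sym (res-quot x))
    where x = + suc r + q * + n

  res-periodic : ∀ x q → res (x + q * + n) ≡ res x
  res-periodic x q = begin
    res (x + q * + n)                              ≡⟨ cong (λ y → res (y + q * + n)) (res-quot x) ⟩
    res (+ suc (res x) + quot x * + n + q * + n)   ≡⟨ cong res (a+bN+cN≡a+[b+c]N (+ suc (res x)) (quot x) q (+ n)) ⟩
    res (+ suc (res x) + (quot x + q) * + n)       ≡⟨ res-+*n (res x) (quot x + q) (res<n x) ⟩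
    res x                                          ∎
    where
    open ≡-Reasoning
    a+bN+cN≡a+[b+c]N : ∀ a b c N → a + b * N + c * N ≡ a + (b + c) * N
    a+bN+cN≡a+[b+c]N = solve-∀

  res-pos : ∀ {r} → r ℕ.< n → res (+ suc r) ≡ r
  res-pos {r} r<n = trans (cong res (sym (ℤₚ.+-identityʳ (+ suc r)))) (res-+*n r 0ℤ r<n)

  res-+n : ∀ x → res (x + + n) ≡ res x
  res-+n x = trans (cong (λ m → res (x + m)) (sym (ℤₚ.*-identityˡ (+ n)))) (res-periodic x 1ℤ)

  n≤[1+m]n : ∀ m → + n ≤ + suc m * + n
  n≤[1+m]n m = subst (+ n ≤_) (ℤₚ.pos-* (suc m) n) (ℤ.+≤+ (ℕₚ.m≤m+n n (m ℕ.* n)))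

  private
    a+sN+qN≡a+[q+s]N : ∀ a s q N → a + s * N + q * N ≡ a + (q + s) * N
    a+sN+qN≡a+[q+s]N = solve-∀

  quot-mono : ∀ {x y} → x ≤ y → quot x ≤ quot y
  quot-mono {x} {y} x≤y = ℤₚ.≮⇒≥ (λ qy<qx → ℤₚ.<⇒≱ (y<x qy<qx) x≤y)
    where
    y<x : quot y < quot x → y < x
    y<x qy<qx with m , qx≡ ← i<j⇒j≡i+suc qy<qx = begin-strict
      y                                                ≡⟨ res-quot y ⟩
      + suc (res y) + quot y * + n                     ≤⟨ ℤₚ.+-monoˡ-≤ (quot y * + n) (ℤ.+≤+ (res<n y)) ⟩
      + n + quot y * + n                               <⟨ ℤₚ.+-monoˡ-< (quot y * + n) n<1+r+[1+m]n ⟩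
      + suc (res x) + + suc m * + n + quot y * + n     ≡⟨ a+sN+qN≡a+[q+s]N (+ suc (res x)) (+ suc m) (quot y) (+ n) ⟩
      + suc (res x) + (quot y + + suc m) * + n         ≡⟨ cong (λ q → + suc (res x) + q * + n) qx≡ ⟨
      + suc (res x) + quot x * + n                     ≡⟨ res-quot x ⟨
      x                                                ∎
      where
      open ℤₚ.≤-Reasoning
      n<1+r+[1+m]n : + n < + suc (res x) + + suc m * + n
      n<1+r+[1+m]n = ℤₚ.<-≤-trans (ℤ.+<+ (ℕₚ.n<1+n n)) (ℤₚ.+-mono-≤ (ℤ.+≤+ (ℕ.s≤s ℕ.z≤n)) (n≤[1+m]n m))

  data SucView (a : ℕ) : Set where
    no-wrap : suc a ℕ.< n → suc a % n ≡ suc a → SucView a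
    wrap    : suc a ≡ n → suc a % n ≡ 0 → SucView a

  sucView : ∀ {a} → a ℕ.< n → SucView a
  sucView {a} a<n with suc a ℕ.<? n
  ... | yes 1+a<n = no-wrap 1+a<n (ℕD.m<n⇒m%n≡m 1+a<n)
  ... | no 1+a≮n  = wrap 1+a≡n (trans (cong (_% n) 1+a≡n) (ℕD.n%n≡0 n))
    where 1+a≡n = ℕₚ.≤-antisym a<n (ℕₚ.≮⇒≥ 1+a≮n)

  res-suc : ∀ x → res (x + 1ℤ) ≡ suc (res x) % n
  res-suc x with sucView (res<n x)
  ... | no-wrap 1+r<n 1+r%n≡1+r = begin
    res (x + 1ℤ)                                    ≡⟨ cong (λ y → res (y + 1ℤ)) (res-quot x) ⟩
    res (+ suc (res x) + quot x * + n + 1ℤ)         ≡⟨ cong res (a+b+1≡1+a+b (+ suc (res x)) (quot x * + n)) ⟩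
    res (+ suc (suc (res x)) + quot x * + n)        ≡⟨ res-+*n (suc (res x)) (quot x) 1+r<n ⟩
    suc (res x)                                     ≡⟨ 1+r%n≡1+r ⟨
    suc (res x) % n                                 ∎
    where open ≡-Reasoning
  ... | wrap 1+r≡n 1+r%n≡0 = begin
    res (x + 1ℤ)                                    ≡⟨ cong (λ y → res (y + 1ℤ)) (res-quot x) ⟩
    res (+ suc (res x) + quot x * + n + 1ℤ)         ≡⟨ cong res (a+b+1≡1+a+b (+ suc (res x)) (quot x * + n)) ⟩
    res (1ℤ + + suc (res x) + quot x * + n)         ≡⟨ cong (λ r → res (1ℤ + + r + quot x * + n)) 1+r≡n ⟩
    res (1ℤ + + n + quot x * + n)                   ≡⟨ cong res (1+N+qN≡1+0+[q+1]N (quot x) (+ n)) ⟩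
    res (+ suc 0 + (quot x + 1ℤ) * + n)             ≡⟨ res-+*n 0 (quot x + 1ℤ) (ℕ.>-nonZero⁻¹ n) ⟩
    0                                               ≡⟨ 1+r%n≡0 ⟨
    suc (res x) % n                                 ∎
    where
    open ≡-Reasoning
    1+N+qN≡1+0+[q+1]N : ∀ q N → 1ℤ + N + q * N ≡ 1ℤ + 0ℤ + (q + 1ℤ) * N
    1+N+qN≡1+0+[q+1]N = solve-∀

  suc%-injective : ∀ {a b} → a ℕ.< n → b ℕ.< n → suc a % n ≡ suc b % n → a ≡ b
  suc%-injective a<n b<n eq with sucView a<n | sucView b<n
  ... | no-wrap _ p | no-wrap _ q = ℕₚ.suc-injective (trans (sym p) (trans eq q))
  ... | no-wrap _ p | wrap _ q with () ← trans (sym p) (trans eq q)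
  ... | wrap _ p | no-wrap _ q with () ← trans (sym q) (trans (sym eq) p)
  ... | wrap p _ | wrap q _ = ℕₚ.suc-injective (trans p (sym q))

  res-pred : ∀ x {j} → j ℕ.< n → res x ≡ suc j % n → res (x - 1ℤ) ≡ j
  res-pred x j<n res≡ = suc%-injective (res<n (x - 1ℤ)) j<n
    (trans (sym (res-suc (x - 1ℤ))) (trans (cong res (i-1+1≡i x)) res≡))

  step : Fin n → ℤ → ℤ
  step = stepPos n

  next : Fin n → ℕ
  next i = suc (toℕ i) % n

  ⟦_⟧ : Word n → ℤ → ℤ
  ⟦_⟧ = pos n

  data StepView (i : Fin n) (p : ℤ) : Set where
    up    : res p ≡ toℕ i → step i p ≡ p + 1ℤ → StepView i p
    down  : res p ≢ toℕ i → res p ≡ next i → step i p ≡ p - 1ℤ → StepView i p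
    fixed : res p ≢ toℕ i → res p ≢ next i → step i p ≡ p → StepView i p

  step-up : ∀ i p → res p ≡ toℕ i → step i p ≡ p + 1ℤ
  step-up i p r≡i with res p ℕ.≟ toℕ i
  ... | yes _  = refl
  ... | no r≢i = ⊥-elim (r≢i r≡i)

  step-down : ∀ i p → res p ≢ toℕ i → res p ≡ next i → step i p ≡ p - 1ℤ
  step-down i p r≢i r≡i⁺ with res p ℕ.≟ toℕ i | res p ℕ.≟ next i
  ... | yes r≡i | _       = ⊥-elim (r≢i r≡i)
  ... | no _    | yes _   = refl
  ... | no _    | no r≢i⁺ = ⊥-elim (r≢i⁺ r≡i⁺)

  step-fixed : ∀ i p → res p ≢ toℕ i → res p ≢ next i → step i p ≡ p
  step-fixed i p r≢i r≢i⁺ with res p ℕ.≟ toℕ i | res p ℕ.≟ next i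
  ... | yes r≡i | _      = ⊥-elim (r≢i r≡i)
  ... | no _    | yes r≡i⁺ = ⊥-elim (r≢i⁺ r≡i⁺)
  ... | no _    | no _   = refl

  stepView : ∀ i p → StepView i p
  stepView i p with res p ℕ.≟ toℕ i | res p ℕ.≟ next i
  ... | yes r≡i | _       = up r≡i (step-up i p r≡i)
  ... | no r≢i  | yes r≡i⁺ = down r≢i r≡i⁺ (step-down i p r≢i r≡i⁺)
  ... | no r≢i  | no r≢i⁺  = fixed r≢i r≢i⁺ (step-fixed i p r≢i r≢i⁺)

  step-+*n : ∀ i p q → step i (p + q * + n) ≡ step i p + q * + n
  step-+*n i p q with stepView i p
  ... | up r≡i eq = begin
    step i (p + q * + n)    ≡⟨ step-up i (p + q * + n) (trans (res-periodic p q) r≡i) ⟩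
    p + q * + n + 1ℤ        ≡⟨ a+b+c≡a+c+b p (q * + n) 1ℤ ⟩
    p + 1ℤ + q * + n        ≡⟨ cong (_+ q * + n) eq ⟨
    step i p + q * + n      ∎
    where open ≡-Reasoning
  ... | down r≢i r≡i⁺ eq = begin
    step i (p + q * + n)    ≡⟨ step-down i (p + q * + n) (r≢i ∘ trans (sym (res-periodic p q)))
                                                          (trans (res-periodic p q) r≡i⁺) ⟩
    p + q * + n - 1ℤ        ≡⟨ a+b+c≡a+c+b p (q * + n) (- 1ℤ) ⟩
    p - 1ℤ + q * + n        ≡⟨ cong (_+ q * + n) eq ⟨
    step i p + q * + n      ∎
    where open ≡-Reasoning
  ... | fixed r≢i r≢i⁺ eq = begin
    step i (p + q * + n)    ≡⟨ step-fixed i (p + q * + n) (r≢i ∘ trans (sym (res-periodic p q)))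
                                                           (r≢i⁺ ∘ trans (sym (res-periodic p q))) ⟩
    p + q * + n             ≡⟨ cong (_+ q * + n) eq ⟨
    step i p + q * + n      ∎
    where open ≡-Reasoning

  pos-++ : ∀ u v x → ⟦ u ++ v ⟧ x ≡ ⟦ v ⟧ (⟦ u ⟧ x)
  pos-++ []      v x = refl
  pos-++ (i ∷ u) v x = pos-++ u v (step i x)

  pos-+*n : ∀ w x q → ⟦ w ⟧ (x + q * + n) ≡ ⟦ w ⟧ x + q * + n
  pos-+*n []      x q = refl
  pos-+*n (i ∷ w) x q = trans (cong ⟦ w ⟧ (step-+*n i x q)) (pos-+*n w (step i x) q)

  pos-+n : ∀ w x → ⟦ w ⟧ (x + + n) ≡ ⟦ w ⟧ x + + n
  pos-+n w x = begin
    ⟦ w ⟧ (x + + n)         ≡⟨ cong (λ m → ⟦ w ⟧ (x + m)) (ℤₚ.*-identityˡ (+ n)) ⟨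
    ⟦ w ⟧ (x + 1ℤ * + n)    ≡⟨ pos-+*n w x 1ℤ ⟩
    ⟦ w ⟧ x + 1ℤ * + n      ≡⟨ cong (_+_ (⟦ w ⟧ x)) (ℤₚ.*-identityˡ (+ n)) ⟩
    ⟦ w ⟧ x + + n           ∎
    where open ≡-Reasoning

  next-injective : ∀ {i j} → next i ≡ next j → toℕ i ≡ toℕ j
  next-injective = suc%-injective (Finₚ.toℕ<n _) (Finₚ.toℕ<n _)

  res-+1 : ∀ i p → res p ≡ toℕ i → res (p + 1ℤ) ≡ next i
  res-+1 i p r≡i = trans (res-suc p) (cong (λ r → suc r % n) r≡i)

  res-1 : ∀ i p → res p ≡ next i → res (p - 1ℤ) ≡ toℕ i
  res-1 i p = res-pred p (Finₚ.toℕ<n i)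

  step≤+1 : ∀ i p → step i p ≤ p + 1ℤ
  step≤+1 i p with stepView i p
  ... | up _ eq      = ℤₚ.≤-reflexive eq
  ... | down _ _ eq  = subst (_≤ p + 1ℤ) (sym eq) (ℤₚ.≤-trans (i-1≤i p) (i≤i+1 p))
  ... | fixed _ _ eq = subst (_≤ p + 1ℤ) (sym eq) (i≤i+1 p)

  -1≤step : ∀ i p → p - 1ℤ ≤ step i p
  -1≤step i p with stepView i p
  ... | up _ eq      = subst (p - 1ℤ ≤_) (sym eq) (ℤₚ.≤-trans (i-1≤i p) (i≤i+1 p))
  ... | down _ _ eq  = ℤₚ.≤-reflexive (sym eq)
  ... | fixed _ _ eq = subst (p - 1ℤ ≤_) (sym eq) (i-1≤i p)

  step-≤ : ∀ i z → res z ≢ toℕ i → step i z ≤ z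
  step-≤ i z r≢i with stepView i z
  ... | up r≡i _     = ⊥-elim (r≢i r≡i)
  ... | down _ _ eq  = subst (_≤ z) (sym eq) (i-1≤i z)
  ... | fixed _ _ eq = ℤₚ.≤-reflexive eq

  swaps-stepˡ : ∀ i x y → Swaps n i x y → step i x ≡ y
  swaps-stepˡ i x _ (r≡i , refl) = step-up i x r≡i

  swaps? : ∀ i x y → Dec (Swaps n i x y)
  swaps? i x y = res x ℕ.≟ toℕ i ×-dec y ℤ.≟ x + 1ℤ

  data Touches (i : Fin n) (p : ℤ) : Set where
    at-i    : res p ≡ toℕ i → Touches i p
    at-next : res p ≡ next i → Touches i p

  touches? : ∀ i p → Dec (Touches i p)
  touches? i p with res p ℕ.≟ toℕ i | res p ℕ.≟ next i
  ... | yes r≡i | _        = yes (at-i r≡i)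
  ... | no _    | yes r≡i⁺ = yes (at-next r≡i⁺)
  ... | no r≢i  | no r≢i⁺  = no λ { (at-i r≡i) → r≢i r≡i ; (at-next r≡i⁺) → r≢i⁺ r≡i⁺ }

  step-untouched : ∀ i p → ¬ Touches i p → step i p ≡ p
  step-untouched i p ¬t = step-fixed i p (¬t ∘ at-i) (¬t ∘ at-next)

  far-untouched : ∀ {i j p} → FarApart n i j → Touches i p → ¬ Touches j p
  far-untouched (i≢j , _ , _)   (at-i r≡i)    (at-i r≡j)  = i≢j (trans (sym r≡i) r≡j)
  far-untouched (_ , _ , j⁺≢i)  (at-i r≡i)    (at-next r≡j⁺) = j⁺≢i (trans (sym r≡j⁺) r≡i)
  far-untouched (_ , i⁺≢j , _)  (at-next r≡i⁺) (at-i r≡j)  = i⁺≢j (trans (sym r≡i⁺) r≡j)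
  far-untouched (i≢j , _ , _)   (at-next r≡i⁺) (at-next r≡j⁺) = i≢j (next-injective (trans (sym r≡i⁺) r≡j⁺))

  far-sym : ∀ {i j} → FarApart n i j → FarApart n j i
  far-sym (i≢j , i⁺≢j , j⁺≢i) = i≢j ∘ sym , j⁺≢i , i⁺≢j

  step-touches : ∀ i {p} → Touches i p → Touches i (step i p)
  step-touches i {p} t with stepView i p
  ... | up r≡i eq      = at-next (subst (λ q → res q ≡ next i) (sym eq) (res-+1 i p r≡i))
  ... | down _ r≡i⁺ eq = at-i (subst (λ q → res q ≡ toℕ i) (sym eq) (res-1 i p r≡i⁺))
  ... | fixed _ _ eq   = subst (Touches i) (sym eq) t

  starts : List ℤ
  starts = startPositions n

  starts-sorted : Linked _<_ starts
  starts-sorted = Linkedₚ.map⁺ (Linkedₚ.applyUpTo⁺₂ id n (λ r → ℤ.+<+ (ℕₚ.n<1+n (suc r))))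

  ∈-starts⁺ : ∀ {r} → r ℕ.< n → + suc r ∈ starts
  ∈-starts⁺ r<n = ∈ₚ.∈-map⁺ (λ k → + suc k) (∈ₚ.∈-upTo⁺ r<n)

  ∈-starts⁻ : ∀ {z} → z ∈ starts → ∃[ r ] r ℕ.< n × z ≡ + suc r
  ∈-starts⁻ z∈ with r , r∈ , refl ← ∈ₚ.∈-map⁻ (λ k → + suc k) z∈ = r , ∈ₚ.∈-upTo⁻ r∈ , refl

  length-starts : length starts ≡ n
  length-starts = trans (Listₚ.length-map (λ k → + suc k) (upTo n)) (Listₚ.length-upTo n)

  InRange : ℤ → Set
  InRange z = + 1 ≤ z × z ≤ + n

  starts-in-range : ∀ {z} → z ∈ starts → InRange z
  starts-in-range z∈ with r , r<n , refl ← ∈-starts⁻ z∈ = ℤ.+≤+ (ℕ.s≤s ℕ.z≤n) , ℤ.+≤+ r<n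

  in-range⇒start : ∀ {z} → InRange z → z ∈ starts
  in-range⇒start {+ suc r}  (_ , ℤ.+≤+ 1+r≤n) = ∈-starts⁺ 1+r≤n
  in-range⇒start {+ zero}   (ℤ.+≤+ () , _)
  in-range⇒start { -[1+ _ ]} (() , _)

  rep : ℤ → ℤ
  rep x = + suc (res x)

  rep-∈ : ∀ x → rep x ∈ starts
  rep-∈ x = ∈-starts⁺ (res<n x)

  rep-start : ∀ {z} → z ∈ starts → rep z ≡ z
  rep-start z∈ with r , r<n , refl ← ∈-starts⁻ z∈ = cong (λ r → + suc r) (res-pos r<n)

  pos-rep : ∀ w x → ⟦ w ⟧ x ≡ ⟦ w ⟧ (rep x) + quot x * + n
  pos-rep w x = trans (cong ⟦ w ⟧ (res-quot x)) (pos-+*n w (rep x) (quot x))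

  right⇒rep-right : ∀ w x → x < ⟦ w ⟧ x → rep x < ⟦ w ⟧ (rep x)
  right⇒rep-right w x x<x′ = +-cancelʳ-< (quot x * + n) (subst₂ _<_ (res-quot x) (pos-rep w x) x<x′)

  rep-right⇒right : ∀ w x → rep x < ⟦ w ⟧ (rep x) → x < ⟦ w ⟧ x
  rep-right⇒right w x r<r′ = subst₂ _<_ (sym (res-quot x)) (sym (pos-rep w x)) (ℤₚ.+-monoˡ-< (quot x * + n) r<r′)

  ∈-rightStarts⁻ : ∀ w {z} → z ∈ rightStarts n w → z ∈ starts × z < ⟦ w ⟧ z
  ∈-rightStarts⁻ w = ∈ₚ.∈-filter⁻ (λ a → a ℤ.<? ⟦ w ⟧ a)

  ∈-rightStarts⁺ : ∀ w {z} → z ∈ starts → z < ⟦ w ⟧ z → z ∈ rightStarts n w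
  ∈-rightStarts⁺ w = ∈ₚ.∈-filter⁺ (λ a → a ℤ.<? ⟦ w ⟧ a)

  rightStarts-sorted : ∀ w → Linked _<_ (rightStarts n w)
  rightStarts-sorted w = Linkedₚ.filter⁺ (λ a → a ℤ.<? ⟦ w ⟧ a) ℤₚ.<-trans starts-sorted

  lastOf-map : ∀ (f : ℤ → ℤ) b bs → lastOf n (f b) (map f bs) ≡ f (lastOf n b bs)
  lastOf-map f b []       = refl
  lastOf-map f b (c ∷ cs) = lastOf-map f c cs

  lastOf-∈ : ∀ b bs → lastOf n b bs ∈ b ∷ bs
  lastOf-∈ b []       = here refl
  lastOf-∈ b (c ∷ cs) = there (lastOf-∈ c cs)

  ≤-lastOf : ∀ {b bs z} → Linked _<_ (b ∷ bs) → z ∈ b ∷ bs → z ≤ lastOf n b bs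
  ≤-lastOf {bs = []}    _           (here refl) = ℤₚ.≤-refl
  ≤-lastOf {bs = _ ∷ _} (b<c ∷ sorted) (here refl) = ℤₚ.<⇒≤ (ℤₚ.<-≤-trans b<c (≤-lastOf sorted (here refl)))
  ≤-lastOf {bs = _ ∷ _} (_ ∷ sorted)   (there z∈) = ≤-lastOf sorted z∈

  wrap-< : ∀ {bs u v} → Linked _<_ bs → WrapBound n bs → u ∈ bs → v ∈ bs → u < v + + n
  wrap-< {b ∷ bs} sorted last<b+n u∈ v∈ =
    ℤₚ.≤-<-trans (≤-lastOf sorted u∈) (ℤₚ.<-≤-trans last<b+n (ℤₚ.+-monoˡ-≤ (+ n) (head≤ sorted v∈)))

  module Webs (2≤n : 2 ℕ.≤ n) where

    suc%≢ : ∀ {a} → a ℕ.< n → suc a % n ≢ a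
    suc%≢ a<n eq with sucView a<n
    ... | no-wrap _ 1+a%n≡1+a = ℕₚ.<-irrefl (sym (trans (sym 1+a%n≡1+a) eq)) (ℕₚ.n<1+n _)
    ... | wrap 1+a≡n 1+a%n≡0 = ℕₚ.<-irrefl (sym n≡1) 2≤n
      where n≡1 = trans (sym 1+a≡n) (cong suc (trans (sym eq) 1+a%n≡0))

    next≢ : ∀ i → next i ≢ toℕ i
    next≢ i = suc%≢ (Finₚ.toℕ<n i)

    step-involutive : ∀ i p → step i (step i p) ≡ p
    step-involutive i p with stepView i p
    ... | up r≡i eq = begin
      step i (step i p)   ≡⟨ cong (step i) eq ⟩
      step i (p + 1ℤ)     ≡⟨ step-down i (p + 1ℤ) (next≢ i ∘ trans (sym (res-+1 i p r≡i))) (res-+1 i p r≡i) ⟩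
      p + 1ℤ - 1ℤ         ≡⟨ i+1-1≡i p ⟩
      p                   ∎
      where open ≡-Reasoning
    ... | down _ r≡i⁺ eq = begin
      step i (step i p)   ≡⟨ cong (step i) eq ⟩
      step i (p - 1ℤ)     ≡⟨ step-up i (p - 1ℤ) (res-1 i p r≡i⁺) ⟩
      p - 1ℤ + 1ℤ         ≡⟨ i-1+1≡i p ⟩
      p                   ∎
      where open ≡-Reasoning
    ... | fixed _ _ eq = trans (cong (step i) eq) eq

    step-injective : ∀ i {x y} → step i x ≡ step i y → x ≡ y
    step-injective i {x} {y} eq = trans (sym (step-involutive i x)) (trans (cong (step i) eq) (step-involutive i y))

    step-comm : ∀ {i j} → FarApart n i j → ∀ x → step i (step j x) ≡ step j (step i x)
    step-comm {i} {j} far x with touches? i x | touches? j x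
    ... | yes tᵢ | _ = trans (cong (step i) (step-untouched j _ (far-untouched far tᵢ)))
                             (sym (step-untouched j _ (far-untouched far (step-touches i tᵢ))))
    ... | no _ | yes tⱼ = trans (step-untouched i _ (far-untouched (far-sym far) (step-touches j tⱼ)))
                                (cong (step j) (sym (step-untouched i _ (far-untouched (far-sym far) tⱼ))))
    ... | no ¬tᵢ | no ¬tⱼ = begin
      step i (step j x)   ≡⟨ cong (step i) (step-untouched j x ¬tⱼ) ⟩
      step i x            ≡⟨ step-untouched i x ¬tᵢ ⟩
      x                   ≡⟨ step-untouched j x ¬tⱼ ⟨
      step j x            ≡⟨ cong (step j) (step-untouched i x ¬tᵢ) ⟨
      step j (step i x)   ∎
      where open ≡-Reasoning

    step-stays-below : ∀ i {z x} → z < x → z ≢ step i x → step i z < x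
    step-stays-below i {z} {x} z<x z≢ = ℤₚ.≤∧≢⇒< (ℤₚ.≤-trans (step≤+1 i z) (i<j⇒i+1≤j z<x))
      (λ eq → z≢ (trans (sym (step-involutive i z)) (cong (step i) eq)))

    step-stays-above : ∀ i {x u} → x < u → u ≢ step i x → x < step i u
    step-stays-above i {x} {u} x<u u≢ = ℤₚ.≤∧≢⇒< (ℤₚ.≤-trans (i<j⇒i≤j-1 x<u) (-1≤step i u))
      (λ eq → u≢ (trans (sym (step-involutive i u)) (cong (step i) (sym eq))))

    swaps-stepʳ : ∀ i x y → Swaps n i x y → step i y ≡ x
    swaps-stepʳ i x y sw = trans (cong (step i) (sym (swaps-stepˡ i x y sw))) (step-involutive i x)

    step-mono : ∀ i {x y} → x < y → ¬ Swaps n i x y → step i x < step i y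
    step-mono i {x} {y} x<y ¬sw with stepView i x
    ... | down _ _ eq = subst (_< step i y) (sym eq)
                          (ℤₚ.<-≤-trans (i-1<i x) (ℤₚ.≤-trans (i<j⇒i≤j-1 x<y) (-1≤step i y)))
    ... | fixed _ _ eq = subst (_< step i y) (sym eq)
                           (step-stays-above i x<y (λ y≡ → ℤₚ.<-irrefl (sym (trans y≡ eq)) x<y))
    ... | up r≡i eq = subst (_< step i y) (sym eq) (above (stepView i y))
      where
      x+1<y : x + 1ℤ < y
      x+1<y = ℤₚ.≤∧≢⇒< (i<j⇒i+1≤j x<y) (λ x+1≡y → ¬sw (r≡i , sym x+1≡y))
      above : StepView i y → x + 1ℤ < step i y
      above (up _ eq′)      = subst (x + 1ℤ <_) (sym eq′) (ℤₚ.<-trans x+1<y (i<i+1 y))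
      above (fixed _ _ eq′) = subst (x + 1ℤ <_) (sym eq′) x+1<y
      above (down _ r≡i⁺ eq′) = subst (x + 1ℤ <_) (sym eq′) (ℤₚ.≤∧≢⇒< (i<j⇒i≤j-1 x+1<y) x+1≢y-1)
        where
        x+1≢y-1 : x + 1ℤ ≢ y - 1ℤ
        x+1≢y-1 eq″ = suc%≢ (res<n (x + 1ℤ)) (begin
          suc (res (x + 1ℤ)) % n   ≡⟨ res-suc (x + 1ℤ) ⟨
          res (x + 1ℤ + 1ℤ)        ≡⟨ cong (λ q → res (q + 1ℤ)) eq″ ⟩
          res (y - 1ℤ + 1ℤ)        ≡⟨ cong res (i-1+1≡i y) ⟩
          res y                    ≡⟨ r≡i⁺ ⟩
          next i                   ≡⟨ res-+1 i x r≡i ⟨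
          res (x + 1ℤ)             ∎)
          where open ≡-Reasoning

    pos-injective : ∀ w {x y} → ⟦ w ⟧ x ≡ ⟦ w ⟧ y → x ≡ y
    pos-injective []      eq = eq
    pos-injective (i ∷ w) eq = step-injective i (pos-injective w eq)

    -- Crossings and webs

    -- CrossAt as an inductive family, so that its indices can be inferred and matched on.
    data Crossing : (w : Word n) → Fin (length w) → ℤ → ℤ → Set where
      here  : ∀ {i w x y} → Swaps n i x y ⊎ Swaps n i y x → Crossing (i ∷ w) Fin.zero x y
      there : ∀ {i w t x y} → Crossing w t (step i x) (step i y) → Crossing (i ∷ w) (Fin.suc t) x y

    crossAt⇒crossing : ∀ w t x y → CrossAt n w t x y → Crossing w t x y
    crossAt⇒crossing (i ∷ w) Fin.zero    x y c = here c
    crossAt⇒crossing (i ∷ w) (Fin.suc t) x y c = there (crossAt⇒crossing w t (step i x) (step i y) c)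

    crossing⇒crossAt : ∀ {w t x y} → Crossing w t x y → CrossAt n w t x y
    crossing⇒crossAt (here c)  = c
    crossing⇒crossAt (there c) = crossing⇒crossAt c

    crossing-sym : ∀ {w t x y} → Crossing w t x y → Crossing w t y x
    crossing-sym (here c)  = here (Sum.swap c)
    crossing-sym (there c) = there (crossing-sym c)

    record Web (w : Word n) : Set where
      field
        bigon-free    : ∀ {s t x y} → Crossing w s x y → Crossing w t x y → s ≡ t
        triangle-free : ∀ {s t u x y z} → Crossing w s x y → Crossing w t y z → Crossing w u x z → ⊥
    open Web

    isWeb⇒web : ∀ {w} → IsWeb n w → Web w
    isWeb⇒web {w} (¬bigon , ¬triangle) = record
      { bigon-free    = λ {s} {t} → bigon-free′ (Finₚ.<-cmp s t)
      ; triangle-free = λ cs ct cu →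
          ¬triangle (_ , _ , _ , _ , _ , _ , crossing⇒crossAt cs , crossing⇒crossAt ct , crossing⇒crossAt cu)
      }
      where
      bigon-free′ : ∀ {s t x y} → Tri (s Fin.< t) (s ≡ t) (t Fin.< s) → Crossing w s x y → Crossing w t x y → s ≡ t
      bigon-free′ (tri< s<t _ _) cs ct = ⊥-elim (¬bigon (_ , _ , _ , _ , s<t , crossing⇒crossAt cs , crossing⇒crossAt ct))
      bigon-free′ (tri≈ _ s≡t _) _  _  = s≡t
      bigon-free′ (tri> _ _ t<s) cs ct = ⊥-elim (¬bigon (_ , _ , _ , _ , t<s , crossing⇒crossAt ct , crossing⇒crossAt cs))

    web⇒isWeb : ∀ {w} → Web w → IsWeb n w
    web⇒isWeb {w} W =
        (λ (x , y , s , t , s<t , cs , ct) →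
           Finₚ.<-irrefl (bigon-free W (crossAt⇒crossing w s x y cs) (crossAt⇒crossing w t x y ct)) s<t)
      , (λ (x , y , z , s , t , u , cs , ct , cu) →
           triangle-free W (crossAt⇒crossing w s x y cs) (crossAt⇒crossing w t y z ct) (crossAt⇒crossing w u x z cu))

    crossing-∷ : ∀ {i w t} x y → Crossing w t x y → Crossing (i ∷ w) (Fin.suc t) (step i x) (step i y)
    crossing-∷ {i} x y c = there (subst₂ (Crossing _ _) (sym (step-involutive i x)) (sym (step-involutive i y)) c)

    web-tail : ∀ {i w} → Web (i ∷ w) → Web w
    web-tail W = record
      { bigon-free    = λ cs ct → Finₚ.suc-injective (bigon-free W (crossing-∷ _ _ cs) (crossing-∷ _ _ ct))
      ; triangle-free = λ cs ct cu → triangle-free W (crossing-∷ _ _ cs) (crossing-∷ _ _ ct) (crossing-∷ _ _ cu)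
      }

    inversion⇒crossing : ∀ w {x y} → x < y → ⟦ w ⟧ y < ⟦ w ⟧ x → ∃[ t ] Crossing w t x y
    inversion⇒crossing []      x<y y′<x′ = ⊥-elim (ℤₚ.<-asym x<y y′<x′)
    inversion⇒crossing (i ∷ w) {x} {y} x<y y′<x′ with swaps? i x y
    ... | yes sw = Fin.zero , here (inj₁ sw)
    ... | no ¬sw with t , c ← inversion⇒crossing w (step-mono i x<y ¬sw) y′<x′ = Fin.suc t , there c

    first-swap-kept : ∀ {i w} p → Web (i ∷ w) → res p ≡ toℕ i → ⟦ w ⟧ p < ⟦ w ⟧ (p + 1ℤ)
    first-swap-kept {i} {w} p W r≡i with ℤₚ.<-cmp (⟦ w ⟧ p) (⟦ w ⟧ (p + 1ℤ))
    ... | tri< p′<p+1′ _ _ = p′<p+1′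
    ... | tri≈ _ p′≡p+1′ _ = ⊥-elim (ℤₚ.<-irrefl (pos-injective w p′≡p+1′) (i<i+1 p))
    ... | tri> _ _ p+1′<p′ with t , c ← inversion⇒crossing w (i<i+1 p) p+1′<p′ =
      ⊥-elim (Finₚ.0≢1+n (bigon-free W (here {x = p + 1ℤ} {y = p} (inj₂ sw)) (there c′)))
      where
      sw = r≡i , refl
      c′ = subst₂ (Crossing w t) (sym (swaps-stepʳ i p (p + 1ℤ) sw)) (sym (swaps-stepˡ i p (p + 1ℤ) sw)) c

    first-swap-inverted : ∀ {i w} p → Web (i ∷ w) → res p ≡ toℕ i → ⟦ i ∷ w ⟧ (p + 1ℤ) < ⟦ i ∷ w ⟧ p
    first-swap-inverted {i} {w} p W r≡i =
      subst₂ (λ a b → ⟦ w ⟧ a < ⟦ w ⟧ b) (sym (swaps-stepʳ i p (p + 1ℤ) sw)) (sym (swaps-stepˡ i p (p + 1ℤ) sw))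
        (first-swap-kept p W r≡i)
      where sw = r≡i , refl

    crossing⇒inversion : ∀ {w t x y} → Web w → Crossing w t x y → x < y → ⟦ w ⟧ y < ⟦ w ⟧ x
    crossing⇒inversion {x = x} W (here (inj₁ (r≡i , refl))) _   = first-swap-inverted x W r≡i
    crossing⇒inversion         W (here (inj₂ (_ , refl)))   x<y = ⊥-elim (ℤₚ.<-asym x<y (i<i+1 _))
    crossing⇒inversion {i ∷ w} {x = x} {y} W (there c) x<y with swaps? i x y
    ... | yes sw = ⊥-elim (Finₚ.0≢1+n (bigon-free W (here {x = x} {y = y} (inj₁ sw)) (there c)))
    ... | no ¬sw = crossing⇒inversion (web-tail W) c (step-mono i x<y ¬sw)

    no-inverted-triple : ∀ {w x y z} → Web w → x < y → y < z → ⟦ w ⟧ y < ⟦ w ⟧ x → ⟦ w ⟧ z < ⟦ w ⟧ y → ⊥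
    no-inverted-triple {w} W x<y y<z y′<x′ z′<y′ =
      triangle-free W (proj₂ (inversion⇒crossing w x<y y′<x′)) (proj₂ (inversion⇒crossing w y<z z′<y′))
                      (proj₂ (inversion⇒crossing w (ℤₚ.<-trans x<y y<z) (ℤₚ.<-trans z′<y′ y′<x′)))

    pos-∷-step : ∀ i w u → ⟦ i ∷ w ⟧ (step i u) ≡ ⟦ w ⟧ u
    pos-∷-step i w u = cong ⟦ w ⟧ (step-involutive i u)

    crossed-from-right : ∀ w {x} → Web w → x ≤ ⟦ w ⟧ x → (x < ⟦ w ⟧ x ⊎ ∃[ z ] z < x × ⟦ w ⟧ x < ⟦ w ⟧ z) →
                         ∃[ u ] x < u × ⟦ w ⟧ u < ⟦ w ⟧ x
    crossed-from-right [] _ _ (inj₁ x<x)            = ⊥-elim (ℤₚ.<-irrefl refl x<x)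
    crossed-from-right [] _ _ (inj₂ (_ , z<x , x<z)) = ⊥-elim (ℤₚ.<-asym z<x x<z)
    crossed-from-right (i ∷ w) {x} W x≤x′ h with stepView i x
    ... | up r≡i _ = x + 1ℤ , i<i+1 x , first-swap-inverted x W r≡i
    ... | down _ r≡i⁺ eq = step i u₁ , x<u , subst₂ _<_ (sym (pos-∷-step i w u₁)) (sym x′≡) u₁′<x₋′
      where
      x₋ = x - 1ℤ
      x′≡ : ⟦ i ∷ w ⟧ x ≡ ⟦ w ⟧ x₋
      x′≡ = cong ⟦ w ⟧ eq
      x₋<x₋′ : x₋ < ⟦ w ⟧ x₋
      x₋<x₋′ = subst (x₋ <_) x′≡ (ℤₚ.<-≤-trans (i-1<i x) x≤x′)
      ih = crossed-from-right w (web-tail W) (ℤₚ.<⇒≤ x₋<x₋′) (inj₁ x₋<x₋′)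
      u₁ = proj₁ ih
      x₋<u₁ = proj₁ (proj₂ ih)
      u₁′<x₋′ = proj₂ (proj₂ ih)
      u₁≢x : u₁ ≢ x
      u₁≢x u₁≡x = ℤₚ.<-asym (subst (λ y → ⟦ w ⟧ y < ⟦ w ⟧ x₋) u₁≡x u₁′<x₋′)
                            (subst (λ y → ⟦ w ⟧ x₋ < ⟦ w ⟧ y) (i-1+1≡i x) (first-swap-kept x₋ W (res-1 i x r≡i⁺)))
      x<u₁ : x < u₁
      x<u₁ = ℤₚ.≤∧≢⇒< (subst (_≤ u₁) (i-1+1≡i x) (i<j⇒i+1≤j x₋<u₁)) (u₁≢x ∘ sym)
      x<u : x < step i u₁
      x<u = step-stays-above i x<u₁ (λ u₁≡ → ℤₚ.<-irrefl (sym (trans u₁≡ eq)) x₋<u₁)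
    ... | fixed _ _ eq = step i u₁ , step-stays-above i x<u₁ (λ u₁≡ → ℤₚ.<-irrefl (sym (trans u₁≡ eq)) x<u₁)
                       , subst₂ _<_ (sym (pos-∷-step i w u₁)) (sym x′≡) u₁′<x′
      where
      x′≡ : ⟦ i ∷ w ⟧ x ≡ ⟦ w ⟧ x
      x′≡ = cong ⟦ w ⟧ eq
      h′ : x < ⟦ w ⟧ x ⊎ ∃[ z ] z < x × ⟦ w ⟧ x < ⟦ w ⟧ z
      h′ = Sum.map (subst (x <_) x′≡)
                   (λ (z , z<x , x′<z′) → step i z , step-stays-below i z<x (λ z≡ → ℤₚ.<-irrefl (trans z≡ eq) z<x)
                                        , subst (_< ⟦ w ⟧ (step i z)) x′≡ x′<z′) h
      ih = crossed-from-right w (web-tail W) (subst (x ≤_) x′≡ x≤x′) h′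
      u₁ = proj₁ ih
      x<u₁ = proj₁ (proj₂ ih)
      u₁′<x′ = proj₂ (proj₂ ih)

    crossed-from-left : ∀ w {x} → Web w → ⟦ w ⟧ x ≤ x → (⟦ w ⟧ x < x ⊎ ∃[ y ] x < y × ⟦ w ⟧ y < ⟦ w ⟧ x) →
                        ∃[ z ] z < x × ⟦ w ⟧ x < ⟦ w ⟧ z
    crossed-from-left [] _ _ (inj₁ x<x)            = ⊥-elim (ℤₚ.<-irrefl refl x<x)
    crossed-from-left [] _ _ (inj₂ (_ , x<y , y<x)) = ⊥-elim (ℤₚ.<-asym x<y y<x)
    crossed-from-left (i ∷ w) {x} W x′≤x h with stepView i x
    ... | down _ r≡i⁺ _ = x - 1ℤ , i-1<i x
      , subst (λ y → ⟦ i ∷ w ⟧ y < ⟦ i ∷ w ⟧ (x - 1ℤ)) (i-1+1≡i x) (first-swap-inverted (x - 1ℤ) W (res-1 i x r≡i⁺))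
    ... | up r≡i eq = step i z₁ , z<x , subst₂ _<_ (sym x′≡) (sym (pos-∷-step i w z₁)) x₊′<z₁′
      where
      x₊ = x + 1ℤ
      x′≡ : ⟦ i ∷ w ⟧ x ≡ ⟦ w ⟧ x₊
      x′≡ = cong ⟦ w ⟧ eq
      x₊′<x₊ : ⟦ w ⟧ x₊ < x₊
      x₊′<x₊ = subst (_< x₊) x′≡ (ℤₚ.≤-<-trans x′≤x (i<i+1 x))
      ih = crossed-from-left w (web-tail W) (ℤₚ.<⇒≤ x₊′<x₊) (inj₁ x₊′<x₊)
      z₁ = proj₁ ih
      z₁<x₊ = proj₁ (proj₂ ih)
      x₊′<z₁′ = proj₂ (proj₂ ih)
      z₁≢x : z₁ ≢ x
      z₁≢x z₁≡x = ℤₚ.<-asym (subst (λ y → ⟦ w ⟧ x₊ < ⟦ w ⟧ y) z₁≡x x₊′<z₁′) (first-swap-kept x W r≡i)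
      z<x : step i z₁ < x
      z<x = step-stays-below i (ℤₚ.≤∧≢⇒< (i<j+1⇒i≤j z₁<x₊) z₁≢x) (λ z₁≡ → ℤₚ.<-irrefl (trans z₁≡ eq) z₁<x₊)
    ... | fixed _ _ eq = step i z₁ , step-stays-below i z₁<x (λ z₁≡ → ℤₚ.<-irrefl (trans z₁≡ eq) z₁<x)
                       , subst₂ _<_ (sym x′≡) (sym (pos-∷-step i w z₁)) x′<z₁′
      where
      x′≡ : ⟦ i ∷ w ⟧ x ≡ ⟦ w ⟧ x
      x′≡ = cong ⟦ w ⟧ eq
      h′ : ⟦ w ⟧ x < x ⊎ ∃[ y ] x < y × ⟦ w ⟧ y < ⟦ w ⟧ x
      h′ = Sum.map (subst (_< x) x′≡)
                   (λ (y , x<y , y′<x′) → step i y , step-stays-above i x<y (λ y≡ → ℤₚ.<-irrefl (sym (trans y≡ eq)) x<y)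
                                        , subst (⟦ w ⟧ (step i y) <_) x′≡ y′<x′) h
      ih = crossed-from-left w (web-tail W) (subst (_≤ x) x′≡ x′≤x) h′
      z₁ = proj₁ ih
      z₁<x = proj₁ (proj₂ ih)
      x′<z₁′ = proj₂ (proj₂ ih)

    right-strands-ordered : ∀ {w x y} → Web w → x < y → x < ⟦ w ⟧ x → y < ⟦ w ⟧ y → ⟦ w ⟧ x < ⟦ w ⟧ y
    right-strands-ordered {w} {x} {y} W x<y x<x′ y<y′ with ℤₚ.<-cmp (⟦ w ⟧ x) (⟦ w ⟧ y)
    ... | tri< x′<y′ _ _ = x′<y′
    ... | tri≈ _ x′≡y′ _ = ⊥-elim (ℤₚ.<-irrefl (pos-injective w x′≡y′) x<y)
    ... | tri> _ _ y′<x′ with u , y<u , u′<y′ ← crossed-from-right w W (ℤₚ.<⇒≤ y<y′) (inj₁ y<y′) =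
      ⊥-elim (no-inverted-triple W x<y y<u y′<x′ u′<y′)

    left-strands-ordered : ∀ {w x y} → Web w → x < y → ⟦ w ⟧ x ≤ x → ⟦ w ⟧ y ≤ y → ⟦ w ⟧ x < ⟦ w ⟧ y
    left-strands-ordered {w} {x} {y} W x<y x′≤x y′≤y with ℤₚ.<-cmp (⟦ w ⟧ x) (⟦ w ⟧ y)
    ... | tri< x′<y′ _ _ = x′<y′
    ... | tri≈ _ x′≡y′ _ = ⊥-elim (ℤₚ.<-irrefl (pos-injective w x′≡y′) x<y)
    ... | tri> _ _ y′<x′ with z , z<x , x′<z′ ← crossed-from-left w W x′≤x (inj₂ (y , x<y , y′<x′)) =
      ⊥-elim (no-inverted-triple W z<x x<y x′<z′ y′<x′)

    -- Isotopy invariance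

    far-swaps-fixed : ∀ i j x y → FarApart n i j → Swaps n i x y → step j x ≡ x × step j y ≡ y
    far-swaps-fixed i j x _ far (r≡i , refl) =
        step-untouched j x (far-untouched far (at-i r≡i))
      , step-untouched j (x + 1ℤ) (far-untouched far (at-next (res-+1 i x r≡i)))

    swaps-far-step : ∀ i j x y → FarApart n i j → Swaps n i x y → Swaps n i (step j x) (step j y)
    swaps-far-step i j x y far sw = subst₂ (Swaps n i) (sym (proj₁ fixes)) (sym (proj₂ fixes)) sw
      where fixes = far-swaps-fixed i j x y far sw

    swaps-far-unstep : ∀ i j x y → FarApart n i j → Swaps n j (step i x) (step i y) → Swaps n j x y
    swaps-far-unstep i j x y far sw = subst₂ (Swaps n j) (unstep x (proj₁ fixes)) (unstep y (proj₂ fixes)) sw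
      where
      fixes = far-swaps-fixed j i (step i x) (step i y) (far-sym far) sw
      unstep : ∀ z → step i (step i z) ≡ step i z → step i z ≡ z
      unstep z fz = trans (sym fz) (step-involutive i z)

    swapIndex : ∀ (u : Word n) a b v → Fin (length (u ++ a ∷ b ∷ v)) → Fin (length (u ++ b ∷ a ∷ v))
    swapIndex []      a b v Fin.zero              = Fin.suc Fin.zero
    swapIndex []      a b v (Fin.suc Fin.zero)    = Fin.zero
    swapIndex []      a b v (Fin.suc (Fin.suc t)) = Fin.suc (Fin.suc t)
    swapIndex (_ ∷ u) a b v Fin.zero              = Fin.zero
    swapIndex (_ ∷ u) a b v (Fin.suc t)           = Fin.suc (swapIndex u a b v t)

    swapIndex-involutive : ∀ (u : Word n) a b v t → swapIndex u b a v (swapIndex u a b v t) ≡ t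
    swapIndex-involutive []      a b v Fin.zero              = refl
    swapIndex-involutive []      a b v (Fin.suc Fin.zero)    = refl
    swapIndex-involutive []      a b v (Fin.suc (Fin.suc t)) = refl
    swapIndex-involutive (_ ∷ u) a b v Fin.zero              = refl
    swapIndex-involutive (_ ∷ u) a b v (Fin.suc t)           = cong Fin.suc (swapIndex-involutive u a b v t)

    swapIndex-injective : ∀ (u : Word n) a b v {s t} → swapIndex u a b v s ≡ swapIndex u a b v t → s ≡ t
    swapIndex-injective u a b v {s} {t} eq = begin
      s                                        ≡⟨ swapIndex-involutive u a b v s ⟨
      swapIndex u b a v (swapIndex u a b v s)  ≡⟨ cong (swapIndex u b a v) eq ⟩
      swapIndex u b a v (swapIndex u a b v t)  ≡⟨ swapIndex-involutive u a b v t ⟩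
      t                                        ∎
      where open ≡-Reasoning

    crossing-commute : ∀ u v {i j t x y} → FarApart n i j →
                       Crossing (u ++ i ∷ j ∷ v) t x y → Crossing (u ++ j ∷ i ∷ v) (swapIndex u i j v t) x y
    crossing-commute [] v {i} {j} {x = x} {y} far (here (inj₁ sw)) = there (here (inj₁ (swaps-far-step i j x y far sw)))
    crossing-commute [] v {i} {j} {x = x} {y} far (here (inj₂ sw)) = there (here (inj₂ (swaps-far-step i j y x far sw)))
    crossing-commute [] v {i} {j} {x = x} {y} far (there (here (inj₁ sw))) = here (inj₁ (swaps-far-unstep i j x y far sw))
    crossing-commute [] v {i} {j} {x = x} {y} far (there (here (inj₂ sw))) = here (inj₂ (swaps-far-unstep i j y x far sw))
    crossing-commute [] v {x = x} {y} far (there (there c)) =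
      there (there (subst₂ (Crossing v _) (step-comm (far-sym far) x) (step-comm (far-sym far) y) c))
    crossing-commute (_ ∷ u) v far (here c)  = here c
    crossing-commute (_ ∷ u) v far (there c) = there (crossing-commute u v far c)

    web-commute : ∀ {w w′} → Commute n w w′ → Web w → Web w′
    web-commute (swap u v i j far) W = record
      { bigon-free    = λ cs ct → swapIndex-injective u j i v (bigon-free W (back cs) (back ct))
      ; triangle-free = λ cs ct cu → triangle-free W (back cs) (back ct) (back cu)
      }
      where
      back : ∀ {t x y} → Crossing (u ++ j ∷ i ∷ v) t x y → Crossing (u ++ i ∷ j ∷ v) (swapIndex u j i v t) x y
      back = crossing-commute u v (far-sym far)

    web-isotopic : ∀ {w w′} → Isotopic n w w′ → Web w → Web w′
    web-isotopic ε        W = W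
    web-isotopic (c ◅ cs) W = web-isotopic cs (web-commute c W)

    pos-commute : ∀ {w w′} → Commute n w w′ → ∀ x → ⟦ w ⟧ x ≡ ⟦ w′ ⟧ x
    pos-commute (swap u v i j far) x = begin
      ⟦ u ++ i ∷ j ∷ v ⟧ x               ≡⟨ pos-++ u (i ∷ j ∷ v) x ⟩
      ⟦ v ⟧ (step j (step i (⟦ u ⟧ x)))  ≡⟨ cong ⟦ v ⟧ (step-comm (far-sym far) (⟦ u ⟧ x)) ⟩
      ⟦ v ⟧ (step i (step j (⟦ u ⟧ x)))  ≡⟨ pos-++ u (j ∷ i ∷ v) x ⟨
      ⟦ u ++ j ∷ i ∷ v ⟧ x               ∎
      where open ≡-Reasoning

    pos-isotopic : ∀ {w w′} → Isotopic n w w′ → ∀ x → ⟦ w ⟧ x ≡ ⟦ w′ ⟧ x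
    pos-isotopic ε        x = refl
    pos-isotopic (c ◅ cs) x = trans (pos-commute c x) (pos-isotopic cs x)

    isotopic-∷ : ∀ i {w w′} → Isotopic n w w′ → Isotopic n (i ∷ w) (i ∷ w′)
    isotopic-∷ i = Star.gmap (λ (w : Word n) → i ∷ w) λ { (swap u v a b far) → swap (i ∷ u) v a b far }

    isotopic-sym : ∀ {w w′} → Isotopic n w w′ → Isotopic n w′ w
    isotopic-sym = Star.reverse λ { (swap u v a b far) → swap u v b a (far-sym far) }

    -- A web is determined by its right strands

    extract-letter : ∀ w {i p} → Web w → res p ≡ toℕ i → ⟦ w ⟧ (p + 1ℤ) < ⟦ w ⟧ p →
                     ∃[ w′ ] Isotopic n w (i ∷ w′)
    extract-letter [] {p = p} _ _ p+1′<p′ = ⊥-elim (ℤₚ.<-asym (i<i+1 p) p+1′<p′)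
    extract-letter (s ∷ w₁) {i} {p} W r≡i p+1′<p′ with s Fin.≟ i
    ... | yes refl = w₁ , ε
    ... | no s≢i with next s ℕ.≟ toℕ i
    ...   | yes s⁺≡i = ⊥-elim (no-inverted-triple W (i-1<i p) (i<i+1 p) p′<p-1′ p+1′<p′)
      where
      p′<p-1′ : ⟦ s ∷ w₁ ⟧ p < ⟦ s ∷ w₁ ⟧ (p - 1ℤ)
      p′<p-1′ = subst (λ q → ⟦ s ∷ w₁ ⟧ q < ⟦ s ∷ w₁ ⟧ (p - 1ℤ)) (i-1+1≡i p)
                  (first-swap-inverted (p - 1ℤ) W (res-1 s p (trans r≡i (sym s⁺≡i))))
    ...   | no s⁺≢i with next i ℕ.≟ toℕ s
    ...     | yes i⁺≡s = ⊥-elim (no-inverted-triple W (i<i+1 p) (i<i+1 (p + 1ℤ)) p+1′<p′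
                           (first-swap-inverted (p + 1ℤ) W (trans (res-+1 i p r≡i) i⁺≡s)))
    ...     | no i⁺≢s = s ∷ w₃ , isotopic-∷ s w₁≃i∷w₃ ◅◅ (swap [] w₃ s i far ◅ ε)
      where
      far : FarApart n s i
      far = s≢i ∘ Finₚ.toℕ-injective , s⁺≢i , i⁺≢s
      fixes = far-swaps-fixed i s p (p + 1ℤ) (far-sym far) (r≡i , refl)
      inverted-in-tail : ⟦ w₁ ⟧ (p + 1ℤ) < ⟦ w₁ ⟧ p
      inverted-in-tail = subst₂ (λ a b → ⟦ w₁ ⟧ a < ⟦ w₁ ⟧ b) (proj₂ fixes) (proj₁ fixes) p+1′<p′
      w₃ = proj₁ (extract-letter w₁ (web-tail W) r≡i inverted-in-tail)
      w₁≃i∷w₃ = proj₂ (extract-letter w₁ (web-tail W) r≡i inverted-in-tail)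

    fixed-strand-not-crossed-from-left : ∀ {w} y → Web w → ⟦ w ⟧ (y + 1ℤ) < ⟦ w ⟧ y → ⟦ w ⟧ (y + 1ℤ) ≢ y + 1ℤ
    fixed-strand-not-crossed-from-left {w} y W y+1′<y′ y+1′≡y+1
      with u , y+1<u , u′<y+1′ ← crossed-from-right w W (ℤₚ.≤-reflexive (sym y+1′≡y+1))
                                                         (inj₂ (y , i<i+1 y , y+1′<y′)) =
      ℤₚ.<-asym u′<y+1′ (left-strands-ordered W y+1<u (ℤₚ.≤-reflexive y+1′≡y+1) u′≤u)
      where
      u′≤u : ⟦ w ⟧ u ≤ u
      u′≤u = ℤₚ.<⇒≤ (ℤₚ.<-trans (subst (⟦ w ⟧ u <_) y+1′≡y+1 u′<y+1′) y+1<u)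

    first-crossing-shape : ∀ {s w} p → Web (s ∷ w) → res p ≡ toℕ s → p < ⟦ s ∷ w ⟧ p × ⟦ s ∷ w ⟧ (p + 1ℤ) ≤ p
    first-crossing-shape {s} {w} p W r≡s =
      p-right , i<j+1⇒i≤j (ℤₚ.≤∧≢⇒< p+1-not-right (fixed-strand-not-crossed-from-left p W inverted))
      where
      inverted = first-swap-inverted p W r≡s
      p+1-not-right : ⟦ s ∷ w ⟧ (p + 1ℤ) ≤ p + 1ℤ
      p+1-not-right with (p + 1ℤ) ℤ.<? ⟦ s ∷ w ⟧ (p + 1ℤ) | p ℤ.<? ⟦ s ∷ w ⟧ p
      ... | no p+1≮ | _ = ℤₚ.≮⇒≥ p+1≮
      ... | yes p+1< | yes p< = ⊥-elim (ℤₚ.<-asym inverted (right-strands-ordered W (i<i+1 p) p< p+1<))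
      ... | yes p+1< | no p≮ = ⊥-elim (ℤₚ.<-asym inverted (ℤₚ.≤-<-trans (ℤₚ.≮⇒≥ p≮) (ℤₚ.<-trans (i<i+1 p) p+1<)))
      p-right : p < ⟦ s ∷ w ⟧ p
      p-right with p ℤ.<? ⟦ s ∷ w ⟧ p
      ... | yes p< = p<
      ... | no p≮ = ⊥-elim (ℤₚ.<-asym inverted (left-strands-ordered W (i<i+1 p) (ℤₚ.≮⇒≥ p≮) p+1-not-right))

    first-letter-tail-not-right : ∀ {s w} p → Web (s ∷ w) → res p ≡ toℕ s → ⟦ w ⟧ p ≤ p
    first-letter-tail-not-right {s} {w} p W r≡s =
      subst (_≤ p) (cong ⟦ w ⟧ (swaps-stepʳ s p (p + 1ℤ) (r≡s , refl))) (proj₂ (first-crossing-shape p W r≡s))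

    SameRight : Word n → Word n → Set
    SameRight w w′ = ∀ x → x < ⟦ w ⟧ x ⊎ x < ⟦ w′ ⟧ x → ⟦ w ⟧ x ≡ ⟦ w′ ⟧ x

    sameRight-isotopic : ∀ {w w′ v} → Isotopic n w′ v → SameRight w w′ → SameRight w v
    sameRight-isotopic w′≃v same x right =
      trans (same x (Sum.map₂ (subst (x <_) (sym (pos-isotopic w′≃v x))) right)) (pos-isotopic w′≃v x)

    sameRight-first-letter : ∀ {s w₁ w′} → Web (s ∷ w₁) → Web w′ → SameRight (s ∷ w₁) w′ →
                             ∃[ w₂ ] Isotopic n w′ (s ∷ w₂)
    sameRight-first-letter {s} {w₁} {w′} W W′ same = extract-letter w′ W′ r≡s inverted′
      where
      p = + suc (toℕ s)
      r≡s : res p ≡ toℕ s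
      r≡s = res-pos (Finₚ.toℕ<n s)
      p-right = proj₁ (first-crossing-shape p W r≡s)
      p+1′≤p = proj₂ (first-crossing-shape p W r≡s)
      p+1″≤p+1 : ⟦ w′ ⟧ (p + 1ℤ) ≤ p + 1ℤ
      p+1″≤p+1 = ℤₚ.≮⇒≥ λ p+1<p+1″ →
        ℤₚ.<-asym (i<i+1 p) (ℤₚ.<-≤-trans (subst (p + 1ℤ <_) (sym (same (p + 1ℤ) (inj₂ p+1<p+1″))) p+1<p+1″) p+1′≤p)
      inverted′ : ⟦ w′ ⟧ (p + 1ℤ) < ⟦ w′ ⟧ p
      inverted′ = ℤₚ.≤∧≢⇒< (ℤₚ.≤-trans p+1″≤p+1 (i<j⇒i+1≤j (subst (p <_) (same p (inj₁ p-right)) p-right)))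
                           (λ eq → ℤₚ.<-irrefl (sym (pos-injective w′ eq)) (i<i+1 p))

    sameRight-∷⁻ : ∀ {s w₁ w₂} → Web (s ∷ w₁) → Web (s ∷ w₂) →
                   SameRight (s ∷ w₁) (s ∷ w₂) → SameRight w₁ w₂
    sameRight-∷⁻ {s} {w₁} {w₂} W₁ W₂ same y right =
      trans (sym (pos-∷-step s w₁ y)) (trans (same (step s y) (right-before (stepView s y) right)) (pos-∷-step s w₂ y))
      where
      right-before : StepView s y → y < ⟦ w₁ ⟧ y ⊎ y < ⟦ w₂ ⟧ y →
                     step s y < ⟦ s ∷ w₁ ⟧ (step s y) ⊎ step s y < ⟦ s ∷ w₂ ⟧ (step s y)
      right-before (up r≡s _) (inj₁ y<y′) = ⊥-elim (ℤₚ.<⇒≱ y<y′ (first-letter-tail-not-right y W₁ r≡s))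
      right-before (up r≡s _) (inj₂ y<y″) = ⊥-elim (ℤₚ.<⇒≱ y<y″ (first-letter-tail-not-right y W₂ r≡s))
      right-before (down _ r≡s⁺ eq) _ =
        inj₁ (subst (λ q → q < ⟦ s ∷ w₁ ⟧ q) (sym eq) (proj₁ (first-crossing-shape (y - 1ℤ) W₁ (res-1 s y r≡s⁺))))
      right-before (fixed _ _ eq) right =
        Sum.map (subst₂ _<_ (sym eq) (sym (pos-∷-step s w₁ y))) (subst₂ _<_ (sym eq) (sym (pos-∷-step s w₂ y))) right

    sameRight⇒isotopic : ∀ w w′ → Web w → Web w′ → SameRight w w′ → Isotopic n w w′
    sameRight⇒isotopic [] [] _ _ _ = ε
    sameRight⇒isotopic [] (s ∷ _) _ W′ same = ⊥-elim (ℤₚ.<-irrefl (same p (inj₂ p-right)) p-right)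
      where
      p = + suc (toℕ s)
      p-right = proj₁ (first-crossing-shape p W′ (res-pos (Finₚ.toℕ<n s)))
    sameRight⇒isotopic (s ∷ w₁) w′ W W′ same with w₂ , w′≃s∷w₂ ← sameRight-first-letter W W′ same =
      isotopic-∷ s (sameRight⇒isotopic w₁ w₂ (web-tail W) (web-tail W₂) same₁) ◅◅ isotopic-sym w′≃s∷w₂
      where
      W₂ = web-isotopic w′≃s∷w₂ W′
      same₁ = sameRight-∷⁻ W W₂ (sameRight-isotopic {s ∷ w₁} w′≃s∷w₂ same)

    -- The right sequence couple

    right-ends-wrap : ∀ w → Web w → ∀ as → All InRange as → All (λ a → a < ⟦ w ⟧ a) as → WrapBound n (map ⟦ w ⟧ as)
    right-ends-wrap w W []       _ _ = tt
    right-ends-wrap w W (a ∷ as) (a-range ∷ as-range) (a-right ∷ as-right) =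
      subst (_< ⟦ w ⟧ a + + n) (sym (lastOf-map ⟦ w ⟧ a as))
        (subst (⟦ w ⟧ last <_) (pos-+n w a) (right-strands-ordered W last<a+n last-right a+n-right))
      where
      last = lastOf n a as
      last∈ = lastOf-∈ a as
      last-right : last < ⟦ w ⟧ last
      last-right = All.lookup (a-right ∷ as-right) last∈
      last<a+n : last < a + + n
      last<a+n = ℤₚ.≤-<-trans (proj₂ (All.lookup (a-range ∷ as-range) last∈))
                   (subst (_< a + + n) (ℤₚ.+-identityˡ (+ n)) (ℤₚ.+-monoˡ-< (+ n) (i+1≤j⇒i<j {0ℤ} (proj₁ a-range))))
      a+n-right : a + + n < ⟦ w ⟧ (a + + n)
      a+n-right = subst (a + + n <_) (sym (pos-+n w a)) (ℤₚ.+-monoˡ-< (+ n) a-right)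

    non-right-start : ∀ w → Web w → ∃[ z ] z ∈ starts × ¬ z < ⟦ w ⟧ z
    non-right-start []       _ = + 1 , ∈-starts⁺ (ℕ.>-nonZero⁻¹ n) , ℤₚ.<-irrefl refl
    non-right-start (s ∷ w₁) W = rep (p + 1ℤ) , rep-∈ (p + 1ℤ) ,
      λ r<r′ → ℤₚ.<⇒≱ (rep-right⇒right (s ∷ w₁) (p + 1ℤ) r<r′)
                      (ℤₚ.≤-trans (proj₂ (first-crossing-shape p W (res-pos (Finₚ.toℕ<n s)))) (i≤i+1 p))
      where p = + suc (toℕ s)

    rsc-IIC : ∀ w → Web w → IIC n (rsc n w)
    rsc-IIC w W = record
      { lenLt  = subst (length (rightStarts n w) ℕ.<_) length-starts
                   (Listₚ.filter-notAll (λ a → a ℤ.<? ⟦ w ⟧ a) starts (Any.map (λ { refl → z-left }) z∈))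
      ; aRange = All.tabulate (starts-in-range ∘ proj₁ ∘ ∈-rightStarts⁻ w)
      ; aIncr  = rightStarts-sorted w
      ; bIncr  = Linkedₚ.map⁺ (linked-map-All (λ x-right y-right x<y → right-strands-ordered W x<y x-right y-right)
                                                right (rightStarts-sorted w))
      ; bWrap  = right-ends-wrap w W (rightStarts n w) (All.tabulate (starts-in-range ∘ proj₁ ∘ ∈-rightStarts⁻ w)) right
      ; aLtb   = All⇒Pointwise-map right
      }
      where
      z = proj₁ (non-right-start w W)
      z∈ = proj₁ (proj₂ (non-right-start w W))
      z-left = proj₂ (proj₂ (non-right-start w W))
      right : All (λ a → a < ⟦ w ⟧ a) (rightStarts n w)
      right = All.tabulate (proj₂ ∘ ∈-rightStarts⁻ w)

    rsc-≡⇒sameRight : ∀ w w′ → rsc n w ≡ rsc n w′ → SameRight w w′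
    rsc-≡⇒sameRight w w′ eq x right = begin
      ⟦ w ⟧ x                        ≡⟨ pos-rep w x ⟩
      ⟦ w ⟧ (rep x) + quot x * + n   ≡⟨ cong (_+ quot x * + n) (map-≡⇒≡ ends≡ rep∈) ⟩
      ⟦ w′ ⟧ (rep x) + quot x * + n  ≡⟨ pos-rep w′ x ⟨
      ⟦ w′ ⟧ x                       ∎
      where
      open ≡-Reasoning
      starts≡ : rightStarts n w ≡ rightStarts n w′
      starts≡ = cong proj₁ eq
      ends≡ : map ⟦ w ⟧ (rightStarts n w) ≡ map ⟦ w′ ⟧ (rightStarts n w)
      ends≡ = trans (cong proj₂ eq) (cong (map ⟦ w′ ⟧) (sym starts≡))
      rep∈ : rep x ∈ rightStarts n w
      rep∈ = Sum.[ (λ x<x′ → ∈-rightStarts⁺ w (rep-∈ x) (right⇒rep-right w x x<x′))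
                 , (λ x<x″ → subst (rep x ∈_) (sym starts≡)
                                     (∈-rightStarts⁺ w′ (rep-∈ x) (right⇒rep-right w′ x x<x″))) ] right

    rsc-cong : ∀ {w w′} → (∀ x → ⟦ w ⟧ x ≡ ⟦ w′ ⟧ x) → rsc n w ≡ rsc n w′
    rsc-cong {w} {w′} w≗w′ =
      cong₂ _,_ starts≡ (trans (cong (map ⟦ w ⟧) starts≡) (Listₚ.map-cong w≗w′ (rightStarts n w′)))
      where
      starts≡ : rightStarts n w ≡ rightStarts n w′
      starts≡ = Listₚ.filter-≐ (λ a → a ℤ.<? ⟦ w ⟧ a) (λ a → a ℤ.<? ⟦ w′ ⟧ a)
                  ((λ {a} → subst (a <_) (w≗w′ a)) , (λ {a} → subst (a <_) (sym (w≗w′ a)))) starts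

    -- Realising right data by a web

    Inverted : Word n → ℤ → ℤ → Set
    Inverted w x y = x < y × ⟦ w ⟧ y < ⟦ w ⟧ x ⊎ y < x × ⟦ w ⟧ x < ⟦ w ⟧ y

    inverted-sym : ∀ {w x y} → Inverted w x y → Inverted w y x
    inverted-sym = Sum.swap

    crossing-irrefl : ∀ {w t x} → ¬ Crossing w t x x
    crossing-irrefl {x = x} (here (inj₁ (_ , x≡x+1))) = ℤₚ.<-irrefl x≡x+1 (i<i+1 x)
    crossing-irrefl {x = x} (here (inj₂ (_ , x≡x+1))) = ℤₚ.<-irrefl x≡x+1 (i<i+1 x)
    crossing-irrefl (there c) = crossing-irrefl c

    crossing⇒inverted : ∀ {w t x y} → Web w → Crossing w t x y → Inverted w x y
    crossing⇒inverted {x = x} {y} W c with ℤₚ.<-cmp x y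
    ... | tri< x<y _ _ = inj₁ (x<y , crossing⇒inversion W c x<y)
    ... | tri≈ _ refl _ = ⊥-elim (crossing-irrefl c)
    ... | tri> _ _ y<x = inj₂ (y<x , crossing⇒inversion W (crossing-sym c) y<x)

    right-strands-not-inverted : ∀ {w x y} → Web w → x < ⟦ w ⟧ x → y < ⟦ w ⟧ y → ¬ Inverted w x y
    right-strands-not-inverted W x<x′ y<y′ (inj₁ (x<y , y′<x′)) =
      ℤₚ.<-asym y′<x′ (right-strands-ordered W x<y x<x′ y<y′)
    right-strands-not-inverted W x<x′ y<y′ (inj₂ (y<x , x′<y′)) =
      ℤₚ.<-asym x′<y′ (right-strands-ordered W y<x y<y′ x<x′)

    left-strands-not-inverted : ∀ {w x y} → Web w → ⟦ w ⟧ x ≤ x → ⟦ w ⟧ y ≤ y → ¬ Inverted w x y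
    left-strands-not-inverted W x′≤x y′≤y (inj₁ (x<y , y′<x′)) =
      ℤₚ.<-asym y′<x′ (left-strands-ordered W x<y x′≤x y′≤y)
    left-strands-not-inverted W x′≤x y′≤y (inj₂ (y<x , x′<y′)) =
      ℤₚ.<-asym x′<y′ (left-strands-ordered W y<x y′≤y x′≤x)

    module _ {i : Fin n} {w : Word n} (W : Web w)
             (kept : ∀ q → res q ≡ toℕ i → ⟦ w ⟧ q < ⟦ w ⟧ (q + 1ℤ))
             (unshared : ∀ q → res q ≡ toℕ i → ∀ z → Inverted w z q → ¬ Inverted w z (q + 1ℤ)) where

      private
        FirstPair : ℤ → ℤ → Set
        FirstPair a b = Swaps n i a b ⊎ Swaps n i b a

        first-step : ∀ a b → FirstPair a b → step i a ≡ b
        first-step a b (inj₁ sw) = swaps-stepˡ i a b sw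
        first-step a b (inj₂ sw) = swaps-stepʳ i b a sw

        first-partner-unique : ∀ a b c → FirstPair a b → FirstPair a c → b ≡ c
        first-partner-unique a b c p q = trans (sym (first-step a b p)) (first-step a c q)

        first-pair-not-inverted : ∀ a b → FirstPair a b → ¬ Inverted w a b
        first-pair-not-inverted q _ (inj₁ (r≡i , refl)) (inj₁ (_ , q+1′<q′)) = ℤₚ.<-asym q+1′<q′ (kept q r≡i)
        first-pair-not-inverted q _ (inj₁ (r≡i , refl)) (inj₂ (q+1<q , _))   = ℤₚ.<-asym q+1<q (i<i+1 q)
        first-pair-not-inverted _ q (inj₂ (r≡i , refl)) (inj₁ (q+1<q , _))   = ℤₚ.<-asym q+1<q (i<i+1 q)
        first-pair-not-inverted _ q (inj₂ (r≡i , refl)) (inj₂ (_ , q+1′<q′)) = ℤₚ.<-asym q+1′<q′ (kept q r≡i)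

        first-pair-unshared : ∀ a b → FirstPair a b → ∀ z → Inverted w z a → ¬ Inverted w z b
        first-pair-unshared q _ (inj₁ (r≡i , refl)) z za zb = unshared q r≡i z za zb
        first-pair-unshared _ q (inj₂ (r≡i , refl)) z za zb = unshared q r≡i z zb za

        no-late-bigon : ∀ a b {t} → FirstPair a b → ¬ Crossing w t (step i a) (step i b)
        no-late-bigon a b p c = first-pair-not-inverted a b p (inverted-sym {w}
          (subst₂ (Inverted w) (first-step a b p) (first-step b a (Sum.swap p)) (crossing⇒inverted W c)))

        no-late-triangle : ∀ a b z {t u} → FirstPair a b →
                           Crossing w t (step i z) (step i a) → Crossing w u (step i z) (step i b) → ⊥
        no-late-triangle a b z p ca cb = first-pair-unshared a b p (step i z)
          (subst (Inverted w _) (first-step b a (Sum.swap p)) (crossing⇒inverted W cb))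
          (subst (Inverted w _) (first-step a b p) (crossing⇒inverted W ca))

      web-∷ : Web (i ∷ w)
      web-∷ = record { bigon-free = bigon-free′ ; triangle-free = triangle-free′ }
        where
        bigon-free′ : ∀ {s t x y} → Crossing (i ∷ w) s x y → Crossing (i ∷ w) t x y → s ≡ t
        bigon-free′ (here _)   (here _)    = refl
        bigon-free′ {x = x} {y} (here p)  (there c) = ⊥-elim (no-late-bigon x y p c)
        bigon-free′ {x = x} {y} (there c) (here p)  = ⊥-elim (no-late-bigon x y p c)
        bigon-free′ (there cs) (there ct)  = cong Fin.suc (bigon-free W cs ct)

        triangle-free′ : ∀ {s t u x y z} → Crossing (i ∷ w) s x y → Crossing (i ∷ w) t y z → Crossing (i ∷ w) u x z → ⊥
        triangle-free′ (there cxy) (there cyz) (there cxz) = triangle-free W cxy cyz cxz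
        triangle-free′ {x = x} {y} {z} (here pxy) (there cyz) (there cxz) =
          no-late-triangle x y z pxy (crossing-sym cxz) (crossing-sym cyz)
        triangle-free′ {x = x} {y} {z} (there cxy) (here pyz) (there cxz) = no-late-triangle y z x pyz cxy cxz
        triangle-free′ {x = x} {y} {z} (there cxy) (there cyz) (here pxz) = no-late-triangle x z y pxz (crossing-sym cxy) cyz
        triangle-free′ {x = x} {y} {z} (here pxy) (here pyz) cxz =
          crossing-irrefl (subst (Crossing _ _ x) (sym (first-partner-unique y x z (Sum.swap pxy) pyz)) cxz)
        triangle-free′ {x = x} {y} {z} (here pxy) cyz (here pxz) =
          crossing-irrefl (subst (Crossing _ _ y) (sym (first-partner-unique x y z pxy pxz)) cyz)
        triangle-free′ {x = x} {y} {z} cxy (here pyz) (here pxz) =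
          crossing-irrefl (subst (Crossing _ _ x) (first-partner-unique z y x (Sum.swap pyz) (Sum.swap pxz)) cxy)

    -- δ r is the displacement of the strands starting at residue r; δ r ≡ 0 means they are not right.
    record RightData : Set where
      field
        δ      : ℕ → ℕ
        δ-mono : ∀ {x y} → x < y → 0 ℕ.< δ (res x) → 0 ℕ.< δ (res y) → x + + δ (res x) < y + + δ (res y)
        δ-gap  : ∃[ r ] r ℕ.< n × δ r ≡ 0
    open RightData

    total : RightData → ℕ
    total D = sumTo (δ D) n

    Covered : Word n → ℤ → Set
    Covered w x = ∃[ z ] z < ⟦ w ⟧ z × z ≤ x × x ≤ ⟦ w ⟧ z

    record Realises (D : RightData) (w : Word n) : Set where
      field
        web             : Web w
        right⇒moves     : ∀ x → x < ⟦ w ⟧ x → 0 ℕ.< δ D (res x)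
        moves⇒end       : ∀ x → 0 ℕ.< δ D (res x) → ⟦ w ⟧ x ≡ x + + δ D (res x)
        uncovered-fixed : ∀ x → ¬ Covered w x → ⟦ w ⟧ x ≡ x
    open Realises

    moves⇒right : ∀ {D w} → Realises D w → ∀ x → 0 ℕ.< δ D (res x) → x < ⟦ w ⟧ x
    moves⇒right R x δ>0 = subst (x <_) (sym (moves⇒end R x δ>0)) (i<i+pos x δ>0)

    resting⇒left : ∀ {D w} → Realises D w → ∀ x → δ D (res x) ≡ 0 → ⟦ w ⟧ x ≤ x
    resting⇒left R x δ≡0 = ℤₚ.≮⇒≥ (λ x<x′ → ℕₚ.<⇒≢ (right⇒moves R x x<x′) (sym δ≡0))

    realises-[] : ∀ D → ¬ (∃[ r ] r ℕ.< n × 0 ℕ.< δ D r) → Realises D []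
    realises-[] D none = record
      { web             = record { bigon-free = λ () ; triangle-free = λ () }
      ; right⇒moves     = λ x x<x → ⊥-elim (ℤₚ.<-irrefl refl x<x)
      ; moves⇒end       = λ x δ>0 → ⊥-elim (none (res x , res<n x , δ>0))
      ; uncovered-fixed = λ _ _ → refl
      }

    -- If w₁ realises D′, in which residue ι no longer moves and residue ι⁺ moves by δ ι ∸ 1,
    -- then i ∷ w₁ realises D.
    module Extend (D : RightData) (i : Fin n) (δι>0 : 0 ℕ.< δ D (toℕ i)) (δι⁺≡0 : δ D (next i) ≡ 0) where

      private
        ι ι⁺ : ℕ
        ι  = toℕ i
        ι⁺ = next i

        δ₀ : ℕ → ℕ
        δ₀ = δ D [ ι ]≔ 0

        1+pred-δι : suc (ℕ.pred (δ D ι)) ≡ δ D ι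
        1+pred-δι = ℕₚ.suc-pred (δ D ι) {{ℕ.>-nonZero δι>0}}

      δ′ : ℕ → ℕ
      δ′ = δ₀ [ ι⁺ ]≔ ℕ.pred (δ D ι)

      δ′-ι : δ′ ι ≡ 0
      δ′-ι = trans (update-other δ₀ _ (next≢ i ∘ sym)) (update-same (δ D) ι 0)

      δ′-ι⁺ : δ′ ι⁺ ≡ ℕ.pred (δ D ι)
      δ′-ι⁺ = update-same δ₀ ι⁺ _

      δ′-other : ∀ {r} → r ≢ ι → r ≢ ι⁺ → δ′ r ≡ δ D r
      δ′-other r≢ι r≢ι⁺ = trans (update-other δ₀ _ r≢ι⁺) (update-other (δ D) 0 r≢ι)

      private
        data Source (x : ℤ) : ℤ → Set where
          itself   : res x ≢ ι → res x ≢ ι⁺ → Source x x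
          previous : res x ≡ ι⁺ → Source x (x - 1ℤ)

        source : ∀ x → 0 ℕ.< δ′ (res x) →
                 ∃[ s ] Source x s × 0 ℕ.< δ D (res s) × x + + δ′ (res x) ≡ s + + δ D (res s)
        source x δ′>0 = by-cases (res x ℕ.≟ ι⁺) (res x ℕ.≟ ι)
          where
          by-cases : Dec (res x ≡ ι⁺) → Dec (res x ≡ ι) →
                     ∃[ s ] Source x s × 0 ℕ.< δ D (res s) × x + + δ′ (res x) ≡ s + + δ D (res s)
          by-cases (yes r≡ι⁺) _ = x - 1ℤ , previous r≡ι⁺ , subst (λ r → 0 ℕ.< δ D r) (sym r₋≡ι) δι>0 , shift≡
            where
            r₋≡ι : res (x - 1ℤ) ≡ ι
            r₋≡ι = res-1 i x r≡ι⁺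
            a+b≡a-1+[1+b] : ∀ a b → a + b ≡ a - 1ℤ + (1ℤ + b)
            a+b≡a-1+[1+b] = solve-∀
            shift≡ : x + + δ′ (res x) ≡ x - 1ℤ + + δ D (res (x - 1ℤ))
            shift≡ = begin
              x + + δ′ (res x)                   ≡⟨ cong (λ r → x + + δ′ r) r≡ι⁺ ⟩
              x + + δ′ ι⁺                        ≡⟨ cong (λ d → x + + d) δ′-ι⁺ ⟩
              x + + ℕ.pred (δ D ι)               ≡⟨ a+b≡a-1+[1+b] x (+ ℕ.pred (δ D ι)) ⟩
              x - 1ℤ + + suc (ℕ.pred (δ D ι))    ≡⟨ cong (λ d → x - 1ℤ + + d) 1+pred-δι ⟩
              x - 1ℤ + + δ D ι                   ≡⟨ cong (λ r → x - 1ℤ + + δ D r) r₋≡ι ⟨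
              x - 1ℤ + + δ D (res (x - 1ℤ))      ∎
              where open ≡-Reasoning
          by-cases (no _) (yes r≡ι) = ⊥-elim (ℕₚ.<⇒≢ δ′>0 (sym (trans (cong δ′ r≡ι) δ′-ι)))
          by-cases (no r≢ι⁺) (no r≢ι) =
            x , itself r≢ι r≢ι⁺ , subst (0 ℕ.<_) (δ′-other r≢ι r≢ι⁺) δ′>0 , cong (λ d → x + + d) (δ′-other r≢ι r≢ι⁺)

        source-mono : ∀ {x y s t} → x < y → Source x s → Source y t → s < t
        source-mono x<y (itself _ _) (itself _ _) = x<y
        source-mono {y = y} x<y (itself r≢ι _) (previous r≡ι⁺) =
          ℤₚ.≤∧≢⇒< (i<j⇒i≤j-1 x<y) (λ x≡y-1 → r≢ι (trans (cong res x≡y-1) (res-1 i y r≡ι⁺)))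
        source-mono {x} x<y (previous _) (itself _ _) = ℤₚ.<-trans (i-1<i x) x<y
        source-mono x<y (previous _) (previous _) = ℤₚ.+-monoˡ-< (- 1ℤ) x<y

      D′ : RightData
      D′ = record
        { δ      = δ′
        ; δ-mono = λ {x} {y} x<y δ′x>0 δ′y>0 → mono′ x<y (source x δ′x>0) (source y δ′y>0)
        ; δ-gap  = ι , Finₚ.toℕ<n i , δ′-ι
        }
        where
        mono′ : ∀ {x y} → x < y →
                ∃[ s ] Source x s × 0 ℕ.< δ D (res s) × x + + δ′ (res x) ≡ s + + δ D (res s) →
                ∃[ t ] Source y t × 0 ℕ.< δ D (res t) × y + + δ′ (res y) ≡ t + + δ D (res t) →
                x + + δ′ (res x) < y + + δ′ (res y)
        mono′ x<y (_ , sx , δs>0 , x≡) (_ , ty , δt>0 , y≡) =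
          subst₂ _<_ (sym x≡) (sym y≡) (δ-mono D (source-mono x<y sx ty) δs>0 δt>0)

      total-D′ : total D′ ℕ.< total D
      total-D′ = begin-strict
        sumTo δ′ n                           ≡⟨ ℕₚ.+-identityʳ _ ⟨
        sumTo δ′ n ℕ.+ 0                     ≡⟨ cong (sumTo δ′ n ℕ.+_) (trans (update-other (δ D) 0 (next≢ i)) δι⁺≡0) ⟨
        sumTo δ′ n ℕ.+ δ₀ ι⁺                 ≡⟨ sumTo-update δ₀ (ℕ.pred (δ D ι)) n (ℕD.m%n<n (suc ι) n) ⟩
        sumTo δ₀ n ℕ.+ ℕ.pred (δ D ι)        <⟨ ℕₚ.+-monoʳ-< (sumTo δ₀ n) (subst (ℕ.pred (δ D ι) ℕ.<_) 1+pred-δι (ℕₚ.n<1+n _)) ⟩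
        sumTo δ₀ n ℕ.+ δ D ι                 ≡⟨ sumTo-update (δ D) 0 n (Finₚ.toℕ<n i) ⟩
        sumTo (δ D) n ℕ.+ 0                  ≡⟨ ℕₚ.+-identityʳ _ ⟩
        sumTo (δ D) n                        ∎
        where open ℕₚ.≤-Reasoning

      module _ {w₁} (R₁ : Realises D′ w₁) where

        private
          δ′-at-ι : ∀ q → res q ≡ ι → δ′ (res q) ≡ 0
          δ′-at-ι q r≡ι = trans (cong δ′ r≡ι) δ′-ι

          left-at-ι : ∀ q → res q ≡ ι → ⟦ w₁ ⟧ q ≤ q
          left-at-ι q r≡ι = resting⇒left R₁ q (δ′-at-ι q r≡ι)

          data NextStrand (q : ℤ) : Set where
            moving  : q + 1ℤ < ⟦ w₁ ⟧ (q + 1ℤ) → NextStrand q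
            resting : ¬ Covered w₁ (q + 1ℤ) → NextStrand q

          uncovered-when-δι≡1 : ∀ q → res q ≡ ι → ℕ.pred (δ D ι) ≡ 0 → ¬ Covered w₁ (q + 1ℤ)
          uncovered-when-δι≡1 q r≡ι pred≡0 (z , z<z′ , z≤q+1 , q+1≤z′) = ℤₚ.<⇒≱ z′<q+1 q+1≤z′
            where
            δ′z>0 = right⇒moves R₁ z z<z′
            rz≢ι : res z ≢ ι
            rz≢ι rz≡ι = ℕₚ.<⇒≢ δ′z>0 (sym (δ′-at-ι z rz≡ι))
            rz≢ι⁺ : res z ≢ ι⁺
            rz≢ι⁺ rz≡ι⁺ = ℕₚ.<⇒≢ δ′z>0 (sym (trans (cong δ′ rz≡ι⁺) (trans δ′-ι⁺ pred≡0)))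
            z<q : z < q
            z<q = ℤₚ.≤∧≢⇒< (i<j+1⇒i≤j (ℤₚ.≤∧≢⇒< z≤q+1 λ z≡q+1 → rz≢ι⁺ (trans (cong res z≡q+1) (res-+1 i q r≡ι))))
                           (λ z≡q → rz≢ι (trans (cong res z≡q) r≡ι))
            δq>0 : 0 ℕ.< δ D (res q)
            δq>0 = subst (λ r → 0 ℕ.< δ D r) (sym r≡ι) δι>0
            z′<q+1 : ⟦ w₁ ⟧ z < q + 1ℤ
            z′<q+1 = begin-strict
              ⟦ w₁ ⟧ z                ≡⟨ moves⇒end R₁ z δ′z>0 ⟩
              z + + δ′ (res z)        ≡⟨ cong (λ d → z + + d) (δ′-other rz≢ι rz≢ι⁺) ⟩
              z + + δ D (res z)       <⟨ δ-mono D z<q (subst (0 ℕ.<_) (δ′-other rz≢ι rz≢ι⁺) δ′z>0) δq>0 ⟩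
              q + + δ D (res q)       ≡⟨ cong (λ r → q + + δ D r) r≡ι ⟩
              q + + δ D ι             ≡⟨ cong (λ d → q + + d) (trans (sym 1+pred-δι) (cong suc pred≡0)) ⟩
              q + 1ℤ                  ∎
              where open ℤₚ.≤-Reasoning

          next-strand : ∀ q → res q ≡ ι → NextStrand q × ⟦ w₁ ⟧ (q + 1ℤ) ≡ q + + δ D ι
          next-strand q r≡ι with ℕ.pred (δ D ι) ℕ.≟ 0
          ... | yes pred≡0 = resting uncovered , (begin
              ⟦ w₁ ⟧ (q + 1ℤ)         ≡⟨ uncovered-fixed R₁ (q + 1ℤ) uncovered ⟩
              q + 1ℤ                  ≡⟨ cong (λ d → q + + d) (trans (cong suc (sym pred≡0)) 1+pred-δι) ⟩
              q + + δ D ι             ∎)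
            where
            open ≡-Reasoning
            uncovered = uncovered-when-δι≡1 q r≡ι pred≡0
          ... | no pred≢0 = moving (moves⇒right R₁ (q + 1ℤ) δ′>0) , (begin
              ⟦ w₁ ⟧ (q + 1ℤ)                        ≡⟨ moves⇒end R₁ (q + 1ℤ) δ′>0 ⟩
              q + 1ℤ + + δ′ (res (q + 1ℤ))           ≡⟨ cong (λ d → q + 1ℤ + + d) δ′-q+1 ⟩
              q + 1ℤ + + ℕ.pred (δ D ι)              ≡⟨ a+1+b≡a+[1+b] q (+ ℕ.pred (δ D ι)) ⟩
              q + + suc (ℕ.pred (δ D ι))             ≡⟨ cong (λ d → q + + d) 1+pred-δι ⟩
              q + + δ D ι                            ∎)
            where
            open ≡-Reasoning
            a+1+b≡a+[1+b] : ∀ a b → a + 1ℤ + b ≡ a + (1ℤ + b)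
            a+1+b≡a+[1+b] = solve-∀
            δ′-q+1 : δ′ (res (q + 1ℤ)) ≡ ℕ.pred (δ D ι)
            δ′-q+1 = trans (cong δ′ (res-+1 i q r≡ι)) δ′-ι⁺
            δ′>0 : 0 ℕ.< δ′ (res (q + 1ℤ))
            δ′>0 = subst (0 ℕ.<_) (sym δ′-q+1) (ℕₚ.n≢0⇒n>0 pred≢0)

          kept : ∀ q → res q ≡ ι → ⟦ w₁ ⟧ q < ⟦ w₁ ⟧ (q + 1ℤ)
          kept q r≡ι = ℤₚ.≤-<-trans (left-at-ι q r≡ι) (subst (q <_) (sym (proj₂ (next-strand q r≡ι))) (i<i+pos q δι>0))

          unshared : ∀ q → res q ≡ ι → ∀ z → Inverted w₁ z q → ¬ Inverted w₁ z (q + 1ℤ)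
          unshared q r≡ι z zq zq+1 with z ℤ.<? ⟦ w₁ ⟧ z | proj₁ (next-strand q r≡ι)
          ... | no z≮z′ | _ = left-strands-not-inverted (web R₁) (ℤₚ.≮⇒≥ z≮z′) (left-at-ι q r≡ι) zq
          ... | yes z<z′ | moving q+1-right = right-strands-not-inverted (web R₁) z<z′ q+1-right zq+1
          ... | yes z<z′ | resting uncovered with zq+1
          ...   | inj₁ (z<q+1 , q+1′<z′) =
                    uncovered (z , z<z′ , ℤₚ.<⇒≤ z<q+1 , ℤₚ.<⇒≤ (subst (_< ⟦ w₁ ⟧ z) (uncovered-fixed R₁ _ uncovered) q+1′<z′))
          ...   | inj₂ (q+1<z , z′<q+1′) =
                    ℤₚ.<-asym z<z′ (ℤₚ.<-trans (subst (⟦ w₁ ⟧ z <_) (uncovered-fixed R₁ _ uncovered) z′<q+1′) q+1<z)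

        extend : Realises D (i ∷ w₁)
        extend = record
          { web             = web-∷ (web R₁) kept unshared
          ; right⇒moves     = right⇒moves′
          ; moves⇒end       = moves⇒end′
          ; uncovered-fixed = uncovered-fixed′
          }
          where
          w = i ∷ w₁

          right⇒moves′ : ∀ x → x < ⟦ w ⟧ x → 0 ℕ.< δ D (res x)
          right⇒moves′ x x<x′ with stepView i x
          ... | up r≡ι _ = subst (λ r → 0 ℕ.< δ D r) (sym r≡ι) δι>0
          ... | down _ r≡ι⁺ eq = ⊥-elim (ℤₚ.<-asym x<x′ (ℤₚ.≤-<-trans x′≤x-1 (i-1<i x)))
            where
            x′≤x-1 : ⟦ w ⟧ x ≤ x - 1ℤ
            x′≤x-1 = subst (_≤ x - 1ℤ) (cong ⟦ w₁ ⟧ (sym eq)) (left-at-ι (x - 1ℤ) (res-1 i x r≡ι⁺))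
          ... | fixed r≢ι r≢ι⁺ eq =
            subst (0 ℕ.<_) (δ′-other r≢ι r≢ι⁺) (right⇒moves R₁ x (subst (x <_) (cong ⟦ w₁ ⟧ eq) x<x′))

          moves⇒end′ : ∀ x → 0 ℕ.< δ D (res x) → ⟦ w ⟧ x ≡ x + + δ D (res x)
          moves⇒end′ x δ>0 with stepView i x
          ... | up r≡ι eq =
            trans (cong ⟦ w₁ ⟧ eq) (trans (proj₂ (next-strand x r≡ι)) (cong (λ r → x + + δ D r) (sym r≡ι)))
          ... | down _ r≡ι⁺ _ = ⊥-elim (ℕₚ.<⇒≢ δ>0 (sym (trans (cong (δ D) r≡ι⁺) δι⁺≡0)))
          ... | fixed r≢ι r≢ι⁺ eq =
            trans (cong ⟦ w₁ ⟧ eq) (trans (moves⇒end R₁ x (subst (0 ℕ.<_) (sym δ′≡) δ>0)) (cong (λ d → x + + d) δ′≡))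
            where δ′≡ = δ′-other r≢ι r≢ι⁺

          uncovered-fixed′ : ∀ x → ¬ Covered w x → ⟦ w ⟧ x ≡ x
          uncovered-fixed′ x uncovered with stepView i x
          ... | up r≡ι eq = ⊥-elim (uncovered (x , x<x′ , ℤₚ.≤-refl , ℤₚ.<⇒≤ x<x′))
            where
            x<x′ : x < ⟦ w ⟧ x
            x<x′ = subst (x <_) (sym (trans (cong ⟦ w₁ ⟧ eq) (proj₂ (next-strand x r≡ι)))) (i<i+pos x δι>0)
          ... | down _ r≡ι⁺ _ = ⊥-elim (uncovered (x - 1ℤ , x-1<x-1′ , i-1≤i x , x≤x-1′))
            where
            r₋≡ι = res-1 i x r≡ι⁺
            x-1′≡ : ⟦ w ⟧ (x - 1ℤ) ≡ x - 1ℤ + + δ D ι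
            x-1′≡ = trans (cong ⟦ w₁ ⟧ (step-up i (x - 1ℤ) r₋≡ι)) (proj₂ (next-strand (x - 1ℤ) r₋≡ι))
            x-1<x-1′ : x - 1ℤ < ⟦ w ⟧ (x - 1ℤ)
            x-1<x-1′ = subst (x - 1ℤ <_) (sym x-1′≡) (i<i+pos (x - 1ℤ) δι>0)
            x≤x-1′ : x ≤ ⟦ w ⟧ (x - 1ℤ)
            x≤x-1′ = subst (x ≤_) (sym x-1′≡) (subst (_≤ x - 1ℤ + + δ D ι) (i-1+1≡i x)
                       (ℤₚ.+-monoʳ-≤ (x - 1ℤ) (ℤ.+≤+ δι>0)))
          ... | fixed _ _ eq = trans (cong ⟦ w₁ ⟧ eq) (uncovered-fixed R₁ x uncovered₁)
            where
            uncovered₁ : ¬ Covered w₁ x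
            uncovered₁ (z , z<z′ , z≤x , x≤z′) =
              uncovered (step i z , ℤₚ.≤-<-trans z₀≤z (subst (z <_) z₀′≡ z<z′)
                                  , ℤₚ.≤-trans z₀≤z z≤x , subst (x ≤_) z₀′≡ x≤z′)
              where
              z₀′≡ : ⟦ w₁ ⟧ z ≡ ⟦ w ⟧ (step i z)
              z₀′≡ = sym (pos-∷-step i w₁ z)
              z₀≤z : step i z ≤ z
              z₀≤z = step-≤ i z (λ rz≡ι → ℕₚ.<⇒≢ (right⇒moves R₁ z z<z′) (sym (δ′-at-ι z rz≡ι)))

    moving-boundary : ∀ D {r} → r ℕ.< n → 0 ℕ.< δ D r → ∃[ p ] 0 ℕ.< δ D (res p) × δ D (res (p + 1ℤ)) ≡ 0
    moving-boundary D {r} r<n δr>0 =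
      x₀ + + j , Pj , ℕₚ.n≤0⇒n≡0 (ℕₚ.≮⇒≥ (¬Pj+1 ∘ subst (λ y → 0 ℕ.< δ D (res y)) (a+b+1≡a+[1+b] x₀ (+ j))))
      where
      x₀ = + suc r
      r₀ = proj₁ (δ-gap D)
      P : ℕ → Set
      P k = 0 ℕ.< δ D (res (x₀ + + k))
      P0 : P 0
      P0 = subst (λ y → 0 ℕ.< δ D (res y)) (sym (ℤₚ.+-identityʳ x₀))
                 (subst (λ r → 0 ℕ.< δ D r) (sym (res-pos r<n)) δr>0)
      k = n ℕ.∸ r ℕ.+ r₀
      x₀+k≡ : x₀ + + k ≡ + suc r₀ + + n
      x₀+k≡ = begin
        + suc r + + (n ℕ.∸ r ℕ.+ r₀)       ≡⟨ ℤₚ.pos-+ (suc r) k ⟨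
        + suc (r ℕ.+ (n ℕ.∸ r ℕ.+ r₀))     ≡⟨ cong (+_ ∘ suc) (ℕₚ.+-assoc r (n ℕ.∸ r) r₀) ⟨
        + suc (r ℕ.+ (n ℕ.∸ r) ℕ.+ r₀)     ≡⟨ cong (λ m → + suc (m ℕ.+ r₀)) (ℕₚ.m+[n∸m]≡n (ℕₚ.<⇒≤ r<n)) ⟩
        + suc (n ℕ.+ r₀)                   ≡⟨ cong (+_ ∘ suc) (ℕₚ.+-comm n r₀) ⟩
        + suc (r₀ ℕ.+ n)                   ≡⟨ ℤₚ.pos-+ (suc r₀) n ⟩
        + suc r₀ + + n                     ∎
        where open ≡-Reasoning
      ¬Pk : ¬ P k
      ¬Pk Pk = ℕₚ.<⇒≢ Pk (sym (begin
        δ D (res (x₀ + + k))          ≡⟨ cong (δ D ∘ res) x₀+k≡ ⟩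
        δ D (res (+ suc r₀ + + n))    ≡⟨ cong (δ D) (trans (res-+n (+ suc r₀)) (res-pos (proj₁ (proj₂ (δ-gap D))))) ⟩
        δ D r₀                        ≡⟨ proj₂ (proj₂ (δ-gap D)) ⟩
        0                             ∎))
        where open ≡-Reasoning
      j = proj₁ (transition (λ k → 0 ℕ.<? δ D (res (x₀ + + k))) P0 k ¬Pk)
      Pj = proj₁ (proj₂ (transition (λ k → 0 ℕ.<? δ D (res (x₀ + + k))) P0 k ¬Pk))
      ¬Pj+1 = proj₂ (proj₂ (transition (λ k → 0 ℕ.<? δ D (res (x₀ + + k))) P0 k ¬Pk))
      a+b+1≡a+[1+b] : ∀ a b → a + b + 1ℤ ≡ a + (1ℤ + b)
      a+b+1≡a+[1+b] = solve-∀

    realise : ∀ f D → total D ℕ.< f → ∃[ w ] Realises D w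
    realise zero    D ()
    realise (suc f) D total<1+f with ℕₚ.anyUpTo? (λ r → 0 ℕ.<? δ D r) n
    ... | no none = [] , realises-[] D none
    ... | yes (r , r<n , δr>0) = i ∷ w₁ , Extend.extend D i δι>0 δι⁺≡0 R₁
      where
      p = proj₁ (moving-boundary D r<n δr>0)
      i = fromℕ< (res<n p)
      ι≡ : toℕ i ≡ res p
      ι≡ = Finₚ.toℕ-fromℕ< (res<n p)
      δι>0 : 0 ℕ.< δ D (toℕ i)
      δι>0 = subst (λ r → 0 ℕ.< δ D r) (sym ι≡) (proj₁ (proj₂ (moving-boundary D r<n δr>0)))
      δι⁺≡0 : δ D (next i) ≡ 0
      δι⁺≡0 = subst (λ r → δ D r ≡ 0) (res-+1 i p (sym ι≡)) (proj₂ (proj₂ (moving-boundary D r<n δr>0)))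
      rec = realise f (Extend.D′ D i δι>0 δι⁺≡0)
                      (ℕₚ.<-≤-trans (Extend.total-D′ D i δι>0 δι⁺≡0) (ℕₚ.≤-pred total<1+f))
      w₁ = proj₁ rec
      R₁ = proj₂ rec

    module FromIIC (as bs : List ℤ) (c : IIC n (as , bs)) where
      open IIC c

      A : ℤ → ℤ
      A = assoc as bs

      -- assoc is the identity off as, so δc r ≡ 0 exactly when + suc r ∉ as.
      δc : ℕ → ℕ
      δc r = ℤ.∣ A (+ suc r) - + suc r ∣

      private
        as⊆starts : ∀ {a} → a ∈ as → a ∈ starts
        as⊆starts = in-range⇒start ∘ All.lookup aRange

        a<A[a] : ∀ {a} → a ∈ as → a < A a
        a<A[a] = assoc-related aLtb

        δc-rep : ∀ x → rep x ∈ as → + δc (res x) ≡ A (rep x) - rep x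
        δc-rep x r∈ = ℤₚ.0≤i⇒+∣i∣≡i (ℤₚ.<⇒≤ (0<j-i (a<A[a] r∈)))

        δc>0⇒rep∈ : ∀ x → 0 ℕ.< δc (res x) → rep x ∈ as
        δc>0⇒rep∈ x δ>0 = assoc-moved⇒∈ (λ A≡ → ℕₚ.<⇒≢ δ>0 (sym (cong ℤ.∣_∣ (ℤₚ.i≡j⇒i-j≡0 A≡))))

        rep∈⇒δc>0 : ∀ x → rep x ∈ as → 0 ℕ.< δc (res x)
        rep∈⇒δc>0 x r∈ = ℤₚ.drop‿+<+ (subst (0ℤ <_) (sym (δc-rep x r∈)) (0<j-i (a<A[a] r∈)))

        shifted : ∀ x → rep x ∈ as → x + + δc (res x) ≡ A (rep x) + quot x * + n
        shifted x r∈ = begin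
          x + + δc (res x)                            ≡⟨ cong₂ _+_ (res-quot x) (δc-rep x r∈) ⟩
          rep x + quot x * + n + (A (rep x) - rep x)  ≡⟨ a+c+[b-a]≡b+c (rep x) (A (rep x)) (quot x * + n) ⟩
          A (rep x) + quot x * + n                    ∎
          where
          open ≡-Reasoning
          a+c+[b-a]≡b+c : ∀ a b c → a + c + (b - a) ≡ b + c
          a+c+[b-a]≡b+c = solve-∀

        δc-mono : ∀ {x y} → x < y → 0 ℕ.< δc (res x) → 0 ℕ.< δc (res y) → x + + δc (res x) < y + + δc (res y)
        δc-mono {x} {y} x<y δx>0 δy>0 =
          subst₂ _<_ (sym (shifted x a∈)) (sym (shifted y b∈)) (by-quotients (ℤₚ.<-cmp (quot x) (quot y)))
          where
          a = rep x
          b = rep y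
          a∈ = δc>0⇒rep∈ x δx>0
          b∈ = δc>0⇒rep∈ y δy>0
          by-quotients : Tri (quot x < quot y) (quot x ≡ quot y) (quot y < quot x) → A a + quot x * + n < A b + quot y * + n
          by-quotients (tri≈ _ qx≡qy _) =
            subst (λ q → A a + quot x * + n < A b + q * + n) qx≡qy
                  (ℤₚ.+-monoˡ-< (quot x * + n) (assoc-mono aIncr bIncr aLtb a∈ b∈ a<b))
            where
            a<b : a < b
            a<b = +-cancelʳ-< (quot x * + n)
                    (subst₂ _<_ (res-quot x) (trans (res-quot y) (cong (λ q → b + q * + n) (sym qx≡qy))) x<y)
          by-quotients (tri< qx<qy _ _) with m , qy≡ ← i<j⇒j≡i+suc qx<qy = begin-strict
            A a + quot x * + n                    <⟨ ℤₚ.+-monoˡ-< (quot x * + n) (wrap-< bIncr bWrap (assoc-∈ aLtb a∈) (assoc-∈ aLtb b∈)) ⟩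
            A b + + n + quot x * + n              ≤⟨ ℤₚ.+-monoˡ-≤ (quot x * + n) (ℤₚ.+-monoʳ-≤ (A b) (n≤[1+m]n m)) ⟩
            A b + + suc m * + n + quot x * + n    ≡⟨ a+sN+qN≡a+[q+s]N (A b) (+ suc m) (quot x) (+ n) ⟩
            A b + (quot x + + suc m) * + n        ≡⟨ cong (λ q → A b + q * + n) qy≡ ⟨
            A b + quot y * + n                    ∎
            where open ℤₚ.≤-Reasoning
          by-quotients (tri> _ _ qy<qx) = ⊥-elim (ℤₚ.<⇒≱ qy<qx (quot-mono (ℤₚ.<⇒≤ x<y)))

        δc-gap : ∃[ r ] r ℕ.< n × δc r ≡ 0
        δc-gap with missing-or-⊆ as starts
        ... | inj₁ (z , z∈ , z∉as) with r , r<n , refl ← ∈-starts⁻ z∈ =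
          r , r<n , ℕₚ.n≤0⇒n≡0 (ℕₚ.≮⇒≥ λ δ>0 → z∉as (subst (_∈ as) (rep-start z∈)
                                     (δc>0⇒rep∈ (+ suc r) (subst (λ r → 0 ℕ.< δc r) (sym (res-pos r<n)) δ>0))))
        ... | inj₂ starts⊆as = ⊥-elim (ℕₚ.<-irrefl (trans (cong length as≡starts) length-starts) lenLt)
          where as≡starts = sorted-extensional ℤₚ.<-trans ℤₚ.<-asym aIncr starts-sorted as⊆starts starts⊆as

      D : RightData
      D = record { δ = δc ; δ-mono = δc-mono ; δ-gap = δc-gap }

      w : Word n
      w = proj₁ (realise (suc (total D)) D (ℕₚ.n<1+n _))

      R : Realises D w
      R = proj₂ (realise (suc (total D)) D (ℕₚ.n<1+n _))

      private
        rightStarts≡ : rightStarts n w ≡ as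
        rightStarts≡ = sorted-extensional ℤₚ.<-trans ℤₚ.<-asym (rightStarts-sorted w) aIncr rs⊆as as⊆rs
          where
          rs⊆as : ∀ {z} → z ∈ rightStarts n w → z ∈ as
          rs⊆as {z} z∈ = subst (_∈ as) (rep-start (proj₁ (∈-rightStarts⁻ w z∈)))
                                (δc>0⇒rep∈ z (right⇒moves R z (proj₂ (∈-rightStarts⁻ w z∈))))
          as⊆rs : ∀ {z} → z ∈ as → z ∈ rightStarts n w
          as⊆rs {z} z∈ = ∈-rightStarts⁺ w (as⊆starts z∈)
            (moves⇒right R z (rep∈⇒δc>0 z (subst (_∈ as) (sym (rep-start (as⊆starts z∈))) z∈)))

        end≡ : ∀ {a} → a ∈ as → ⟦ w ⟧ a ≡ A a
        end≡ {a} a∈ = begin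
          ⟦ w ⟧ a                  ≡⟨ moves⇒end R a (rep∈⇒δc>0 a r∈) ⟩
          a + + δc (res a)         ≡⟨ cong (_+_ a) (δc-rep a r∈) ⟩
          a + (A (rep a) - rep a)  ≡⟨ cong (λ r → a + (A r - r)) (rep-start (as⊆starts a∈)) ⟩
          a + (A a - a)            ≡⟨ a+[b-a]≡b a (A a) ⟩
          A a                      ∎
          where
          open ≡-Reasoning
          r∈ = subst (_∈ as) (sym (rep-start (as⊆starts a∈))) a∈
          a+[b-a]≡b : ∀ a b → a + (b - a) ≡ b
          a+[b-a]≡b = solve-∀

      rsc≡ : rsc n w ≡ (as , bs)
      rsc≡ = cong₂ _,_ rightStarts≡
        (trans (cong (map ⟦ w ⟧) rightStarts≡) (trans (Listₚ.map-cong-local (All.tabulate end≡)) (map-assoc aIncr aLtb)))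

open import Data.Nat using (_≤_)

proposition5p3 : (n : ℕ) .{{_ : NonZero n}} → 2 ≤ n →
    -- ϱ̃ takes values in IIC_n
    (∀ (w : Word n) → IsWeb n w → IIC n (rsc n w))
    -- ϱ̃ is well defined on isotopy classes
    × (∀ (w w′ : Word n) → IsWeb n w → IsWeb n w′ → Isotopic n w w′ → rsc n w ≡ rsc n w′)
    -- injective on isotopy classes
    × (∀ (w w′ : Word n) → IsWeb n w → IsWeb n w′ → rsc n w ≡ rsc n w′ → Isotopic n w w′)
    -- surjective onto IIC_n
    × (∀ (c : List ℤ × List ℤ) → IIC n c → Σ (Word n) (λ w → IsWeb n w × rsc n w ≡ c))
proposition5p3 n 2≤n =
    (λ w w-web → rsc-IIC w (isWeb⇒web w-web))
  , (λ w w′ _ _ w≃w′ → rsc-cong {w} {w′} (pos-isotopic w≃w′))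
  , (λ w w′ w-web w′-web same-rsc →
       sameRight⇒isotopic w w′ (isWeb⇒web w-web) (isWeb⇒web w′-web) (rsc-≡⇒sameRight w w′ same-rsc))
  , (λ (as , bs) c → FromIIC.w as bs c , web⇒isWeb (Realises.web (FromIIC.R as bs c)) , FromIIC.rsc≡ as bs c)
  where open Cover.Webs n 2≤n
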